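{- Let $f(k)$ denote the minimum number of edges in an oriented $k$-graph with Property O. Then $f(k) \ge k!$ for every integer $k \ge 2$, and there exists $k_0$ such that $f(k) \le (k^2 \ln k)\, k!$ for all $k \ge k_0$.
   Context: Fix an integer $k \ge 2$ and a finite set $V$. An ordered $k$-set is a $k$-tuple $(x_1,\dots,x_k)$ of distinct elements of $V$. An oriented $k$-graph (oriented $k$-uniform hypergraph) is a pair $\mathcal{H}=(V,\mathcal{E})$ where $\mathcal{E}\subseteq V^k$ is a family of ordered $k$-sets such that no two members of $\mathcal{E}$ have the same underlying $k$-element set; its edges are the members of $\mathcal{E}$. Given a linear order $<$ on $V$, an ordered $k$-set $(x_1,\dots,x_k)$ is consistent with $<$ if $x_1<x_2<\dots<x_k$. An oriented $k$-graph $\mathcal{H}=(V,\mathcal{E})$ has Property O (the ordering property) if for every linear order $<$ of $V$ there exists some edge in $\mathcal{E}$ consistent with $<$. -}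

module Defs where

open import Data.Nat as ℕ using (ℕ; zero; suc)
open import Data.Fin as Fin using (Fin)
open import Data.List using (List; length; lookup)
open import Data.Product using (∃; _×_; Σ)
open import Data.Integer using (+_)
open import Data.Rational as ℚ using (ℚ; _/_; 1ℚ)
open import Function.Definitions using (Injective)
open import Function.Bundles using (_⇔_)
open import Relation.Binary.PropositionalEquality using (_≡_)
open import Relation.Binary.Structures using (IsStrictTotalOrder)
open import Relation.Nullary using (¬_)

OrderedKSet : ℕ → ℕ → Set
OrderedKSet k n = Fin k → Fin n

_∈ᵤ_ : ∀ {k n} → Fin n → OrderedKSet k n → Set
x ∈ᵤ e = ∃ λ i → e i ≡ x

SameUnderlyingSet : ∀ {k n} → OrderedKSet k n → OrderedKSet k n → Set
SameUnderlyingSet e e′ = ∀ x → (x ∈ᵤ e) ⇔ (x ∈ᵤ e′)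

-- An oriented k-graph on the finite vertex set Fin n: its edge family is
-- given as a list of ordered k-sets; every entry has distinct coordinates and
-- no two entries (at different positions) have the same underlying set.
-- In particular the entries are pairwise distinct, so the number of edges
-- is the length of the list.
record OrientedKGraph (k n : ℕ) : Set where
  field
    edges    : List (OrderedKSet k n)
    distinct : ∀ i → Injective _≡_ _≡_ (lookup edges i)
    oriented : ∀ i j → ¬ i ≡ j →
               ¬ SameUnderlyingSet (lookup edges i) (lookup edges j)

open OrientedKGraph public

numEdges : ∀ {k n} → OrientedKGraph k n → ℕ
numEdges H = length (edges H)

IsLinearOrder : ∀ {n} → (Fin n → Fin n → Set) → Set
IsLinearOrder _<_ = IsStrictTotalOrder _≡_ _<_

ConsistentWith : ∀ {k n} → (Fin n → Fin n → Set) → OrderedKSet k n → Set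
ConsistentWith _<_ e = ∀ i j → i Fin.< j → e i < e j

PropertyO : ∀ {k n} → OrientedKGraph k n → Set₁
PropertyO {n = n} H =
  (_<_ : Fin n → Fin n → Set) → IsLinearOrder _<_ →
  ∃ λ i → ConsistentWith _<_ (lookup (edges H) i)

expTerm : ℚ → ℕ → ℚ
expTerm q zero    = 1ℚ
expTerm q (suc j) = expTerm q j ℚ.* q ℚ.* (+ 1 / suc j)

expPartial : ℚ → ℕ → ℚ
expPartial q zero    = 1ℚ
expPartial q (suc N) = expPartial q N ℚ.+ expTerm q (suc N)

-- For 0 ≤ q and k ≥ 1:  q ≤ ln k  ⇔  e^q ≤ k  ⇔  every partial sum of the
-- (nonnegative-term) exponential series at q is ≤ k.
_≤ln_ : ℚ → ℕ → Set
q ≤ln k = ℚ.0ℚ ℚ.≤ q × (∀ N → expPartial q N ℚ.≤ (+ k / 1))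

-- m ≤ c · ln k  (for naturals m, c, k ≥ 2): there is a rational L with
-- 0 ≤ L ≤ ln k and m ≤ c · L.  (Equivalent since ln k is irrational for
-- k ≥ 2, so m < c·ln k whenever m ≤ c·ln k and c > 0.)
_≤_*ln_ : ℕ → ℕ → ℕ → Set
m ≤ c *ln k = ∃ λ L → L ≤ln k × (+ m / 1) ℚ.≤ (+ c / 1) ℚ.* L

-- Lower bound: in a uniformly random linear order each edge is consistent with probability 1/k!,
-- so with fewer than k! edges some order has no consistent edge. The order is found by the method
-- of conditional expectations, fixing the lowest vertex first, one vertex at a time.
--
-- Upper bound: split k·a vertices (a ≈ 5k/12) into k classes of size a and take m = k²·k!·t of the
-- aᵏ transversals, where (20/19)^{20t} ≤ k certifies t ≤ ln k. Orient them one after the other,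
-- each time choosing, among the k! orientations, the one consistent with the most rankings of the
-- vertices that are still consistent with no chosen edge. Every such ranking is consistent with one
-- of the k! orientations, so each step removes a 1/k! fraction, and (1 − 1/k!)ᵐ nⁿ < 1 leaves none.
-- The estimates m ≤ aᵏ and (1 − 1/k!)ᵐ nⁿ < 1 rest on k! ≤ 3 (20/49)ᵏ kᵏ and (1 − 1/K)ᴷ ≤ 5/12.

module Submission where

open import Defs

module ExponentialSeries where

  open import Data.Nat as ℕ using (ℕ; zero; suc)
  import Data.Nat.Properties as ℕP
  open import Data.Integer as ℤ using (+_)
  import Data.Integer.Properties as ℤP
  open import Data.Rational as ℚ using (ℚ; _/_; 0ℚ; 1ℚ; _+_; _*_; _-_; _≤_)
  open import Data.Rational.Properties
  open import Data.Rational.Unnormalised as ℚᵘ using (mkℚᵘ; *≡*; *≤*)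
  import Data.Rational.Unnormalised.Properties as ℚᵘP
  open import Data.Rational.Solver using (module +-*-Solver)
  open import Data.Product using (_,_)
  open import Relation.Binary.PropositionalEquality
  open +-*-Solver

  ι : ℕ → ℚ
  ι n = + n / 1

  private
    toℚᵘ-ι : ∀ n → ℚ.toℚᵘ (ι n) ℚᵘ.≃ mkℚᵘ (+ n) 0
    toℚᵘ-ι n = toℚᵘ-fromℚᵘ (mkℚᵘ (+ n) 0)

  ι-+ : ∀ m n → ι (m ℕ.+ n) ≡ ι m + ι n
  ι-+ m n = toℚᵘ-injective (begin
    ℚ.toℚᵘ (ι (m ℕ.+ n))                ≈⟨ toℚᵘ-ι (m ℕ.+ n) ⟩
    mkℚᵘ (+ (m ℕ.+ n)) 0                ≈⟨ *≡* (cong (ℤ._* + 1) (trans (ℤP.pos-+ m n)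
                                             (sym (cong₂ ℤ._+_ (ℤP.*-identityʳ (+ m)) (ℤP.*-identityʳ (+ n)))))) ⟩
    mkℚᵘ (+ m) 0 ℚᵘ.+ mkℚᵘ (+ n) 0      ≈⟨ ℚᵘP.+-cong (toℚᵘ-ι m) (toℚᵘ-ι n) ⟨
    ℚ.toℚᵘ (ι m) ℚᵘ.+ ℚ.toℚᵘ (ι n)      ≈⟨ toℚᵘ-homo-+ (ι m) (ι n) ⟨
    ℚ.toℚᵘ (ι m + ι n)                  ∎)
    where open ℚᵘP.≃-Reasoning

  ι-* : ∀ m n → ι (m ℕ.* n) ≡ ι m * ι n
  ι-* m n = toℚᵘ-injective (begin
    ℚ.toℚᵘ (ι (m ℕ.* n))                ≈⟨ toℚᵘ-ι (m ℕ.* n) ⟩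
    mkℚᵘ (+ (m ℕ.* n)) 0                ≈⟨ *≡* (cong (ℤ._* + 1) (ℤP.pos-* m n)) ⟩
    mkℚᵘ (+ m) 0 ℚᵘ.* mkℚᵘ (+ n) 0      ≈⟨ ℚᵘP.*-cong (toℚᵘ-ι m) (toℚᵘ-ι n) ⟨
    ℚ.toℚᵘ (ι m) ℚᵘ.* ℚ.toℚᵘ (ι n)      ≈⟨ toℚᵘ-homo-* (ι m) (ι n) ⟨
    ℚ.toℚᵘ (ι m * ι n)                  ∎)
    where open ℚᵘP.≃-Reasoning

  ι-mono-≤ : ∀ {m n} → m ℕ.≤ n → ι m ≤ ι n
  ι-mono-≤ {m} {n} m≤n = toℚᵘ-cancel-≤ (ℚᵘP.≤-respʳ-≃ (ℚᵘP.≃-sym (toℚᵘ-ι n))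
    (ℚᵘP.≤-respˡ-≃ (ℚᵘP.≃-sym (toℚᵘ-ι m)) (*≤* (ℤP.*-monoʳ-≤-nonNeg (+ 1) (ℤ.+≤+ m≤n)))))

  ι-suc : ∀ n → ι (suc n) ≡ ι n + 1ℚ
  ι-suc n = trans (cong ι (ℕP.+-comm 1 n)) (ι-+ n 1)

  ι*1/ι≡1 : ∀ n → ι (suc n) * (+ 1 / suc n) ≡ 1ℚ
  ι*1/ι≡1 n = toℚᵘ-injective (begin
    ℚ.toℚᵘ (ι (suc n) * (+ 1 / suc n))               ≈⟨ toℚᵘ-homo-* (ι (suc n)) (+ 1 / suc n) ⟩
    ℚ.toℚᵘ (ι (suc n)) ℚᵘ.* ℚ.toℚᵘ (+ 1 / suc n)     ≈⟨ ℚᵘP.*-cong (toℚᵘ-ι (suc n)) (toℚᵘ-fromℚᵘ (mkℚᵘ (+ 1) n)) ⟩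
    mkℚᵘ (+ suc n) 0 ℚᵘ.* mkℚᵘ (+ 1) n               ≈⟨ *≡* (trans (ℤP.*-identityʳ _) (trans (ℤP.*-identityʳ _)
                                                           (sym (trans (ℤP.*-identityˡ _) (cong (λ d → + suc d) (ℕP.+-identityʳ n)))))) ⟩
    mkℚᵘ (+ 1) 0                                      ∎)
    where open ℚᵘP.≃-Reasoning

  private
    *-mono-≤ˡ : ∀ {r p q} → 0ℚ ≤ r → p ≤ q → r * p ≤ r * q
    *-mono-≤ˡ {r} 0≤r = *-monoˡ-≤-nonNeg r {{ℚ.nonNegative 0≤r}}

    *-mono-≤ʳ : ∀ {r p q} → 0ℚ ≤ r → p ≤ q → p * r ≤ q * r
    *-mono-≤ʳ {r} 0≤r = *-monoʳ-≤-nonNeg r {{ℚ.nonNegative 0≤r}}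

    0≤* : ∀ {p q} → 0ℚ ≤ p → 0ℚ ≤ q → 0ℚ ≤ p * q
    0≤* {p} 0≤p 0≤q = ≤-trans (≤-reflexive (sym (*-zeroʳ p))) (*-mono-≤ˡ 0≤p 0≤q)

    ≤-+ʳ : ∀ {p q} → 0ℚ ≤ q → p ≤ p + q
    ≤-+ʳ {p} 0≤q = ≤-trans (≤-reflexive (sym (+-identityʳ p))) (+-monoʳ-≤ p 0≤q)

    0≤1/ : ∀ n → 0ℚ ≤ + 1 / suc n
    0≤1/ n = nonNegative⁻¹ (+ 1 / suc n) {{normalize-nonNeg 1 (suc n)}}

    0≤ι : ∀ n → 0ℚ ≤ ι n
    0≤ι n = ι-mono-≤ {0} {n} ℕ.z≤n

  expTerm-nonNeg : ∀ {q} → 0ℚ ≤ q → ∀ j → 0ℚ ≤ expTerm q j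
  expTerm-nonNeg 0≤q zero    = ≤ᵇ⇒≤ _
  expTerm-nonNeg 0≤q (suc j) = 0≤* (0≤* (expTerm-nonNeg 0≤q j) 0≤q) (0≤1/ j)

  expPartial-≤-suc : ∀ {q} → 0ℚ ≤ q → ∀ N → expPartial q N ≤ expPartial q (suc N)
  expPartial-≤-suc 0≤q N = ≤-+ʳ (expTerm-nonNeg 0≤q (suc N))

  -- The discrete mean value inequality (v + d)ⁱ⁺¹ − vⁱ⁺¹ ≤ (i + 1) d (v + d)ⁱ, divided by (i + 1)!.
  expTerm-shift : ∀ {v d} → 0ℚ ≤ v → 0ℚ ≤ d → ∀ i →
                  expTerm (v + d) (suc i) ≤ expTerm v (suc i) + d * expTerm (v + d) i
  expTerm-shift {v} {d} 0≤v 0≤d zero = ≤-reflexive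
    (solve 2 (λ v d → (con 1ℚ :* (v :+ d)) :* con 1ℚ := (con 1ℚ :* v) :* con 1ℚ :+ d :* con 1ℚ) refl v d)
  expTerm-shift {v} {d} 0≤v 0≤d (suc i) = begin
    A * u * c
      ≡⟨ solve 4 (λ A v d c → A :* (v :+ d) :* c := (v :* c) :* A :+ d :* (c :* A)) refl A v d c ⟩
    (v * c) * A + d * (c * A)
      ≤⟨ +-monoˡ-≤ (d * (c * A)) (*-mono-≤ˡ (0≤* 0≤v (0≤1/ (suc i))) (expTerm-shift 0≤v 0≤d i)) ⟩
    (v * c) * (B + d * Tᵢ) + d * (c * A)
      ≡⟨ solve 6 (λ A B Tᵢ v d c → (v :* c) :* (B :+ d :* Tᵢ) :+ d :* (c :* A)
                                  := B :* v :* c :+ d :* (c :* (Tᵢ :* v :+ A))) refl A B Tᵢ v d c ⟩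
    B * v * c + d * (c * (Tᵢ * v + A))
      ≤⟨ +-monoʳ-≤ (B * v * c) (*-mono-≤ˡ 0≤d c[Tᵢv+A]≤A) ⟩
    B * v * c + d * A ∎
    where
    open ≤-Reasoning
    u = v + d
    c = + 1 / suc (suc i)
    A = expTerm u (suc i)
    B = expTerm v (suc i)
    Tᵢ = expTerm u i
    Tᵢu≡[1+i]A : Tᵢ * u ≡ ι (suc i) * A
    Tᵢu≡[1+i]A = begin-equality
      Tᵢ * u                                  ≡⟨ *-identityʳ (Tᵢ * u) ⟨
      Tᵢ * u * 1ℚ                             ≡⟨ cong (Tᵢ * u *_) (ι*1/ι≡1 i) ⟨
      Tᵢ * u * (ι (suc i) * (+ 1 / suc i))    ≡⟨ solve 4 (λ T u a c → T :* u :* (a :* c) := a :* (T :* u :* c))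
                                                        refl Tᵢ u (ι (suc i)) (+ 1 / suc i) ⟩
      ι (suc i) * A                           ∎
    c[Tᵢv+A]≤A : c * (Tᵢ * v + A) ≤ A
    c[Tᵢv+A]≤A = begin
      c * (Tᵢ * v + A)
        ≤⟨ *-mono-≤ˡ (0≤1/ (suc i)) (+-monoˡ-≤ A (*-mono-≤ˡ (expTerm-nonNeg (+-mono-≤ 0≤v 0≤d) i) (≤-+ʳ 0≤d))) ⟩
      c * (Tᵢ * u + A)            ≡⟨ cong (λ z → c * (z + A)) Tᵢu≡[1+i]A ⟩
      c * (ι (suc i) * A + A)     ≡⟨ solve 3 (λ c a A → c :* (a :* A :+ A) := (c :* (a :+ con 1ℚ)) :* A) refl c (ι (suc i)) A ⟩
      c * (ι (suc i) + 1ℚ) * A    ≡⟨ cong (λ z → c * z * A) (ι-suc (suc i)) ⟨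
      c * ι (suc (suc i)) * A     ≡⟨ cong (_* A) (trans (*-comm c _) (ι*1/ι≡1 (suc i))) ⟩
      1ℚ * A                      ≡⟨ *-identityˡ A ⟩
      A                           ∎

  private
    expPartial-shift′ : ∀ {v d} → 0ℚ ≤ v → 0ℚ ≤ d → ∀ N →
                        expPartial (v + d) (suc N) ≤ expPartial v (suc N) + d * expPartial (v + d) N
    expPartial-shift′ {v} {d} 0≤v 0≤d zero = begin
      1ℚ + expTerm (v + d) 1              ≤⟨ +-monoʳ-≤ 1ℚ (expTerm-shift 0≤v 0≤d 0) ⟩
      1ℚ + (expTerm v 1 + d * 1ℚ)         ≡⟨ +-assoc 1ℚ (expTerm v 1) (d * 1ℚ) ⟨
      1ℚ + expTerm v 1 + d * 1ℚ           ∎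
      where open ≤-Reasoning
    expPartial-shift′ {v} {d} 0≤v 0≤d (suc N) = begin
      F u (suc N) + T u (2+N)
        ≤⟨ +-mono-≤ (expPartial-shift′ 0≤v 0≤d N) (expTerm-shift 0≤v 0≤d (suc N)) ⟩
      (F v (suc N) + d * F u N) + (T v (2+N) + d * T u (suc N))
        ≡⟨ solve 5 (λ a b c e d → (a :+ d :* b) :+ (c :+ d :* e) := (a :+ c) :+ d :* (b :+ e)) refl
                   (F v (suc N)) (F u N) (T v (2+N)) (T u (suc N)) d ⟩
      (F v (suc N) + T v (2+N)) + d * (F u N + T u (suc N)) ∎
      where
      open ≤-Reasoning
      F = expPartial
      T = expTerm
      u = v + d
      2+N = suc (suc N)

  expPartial-shift : ∀ {v d} → 0ℚ ≤ v → 0ℚ ≤ d → ∀ N →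
                     expPartial (v + d) N * (1ℚ - d) ≤ expPartial v N
  expPartial-shift {v} {d} 0≤v 0≤d N = begin
    F u N * (1ℚ - d)          ≡⟨ solve 2 (λ f d → f :* (con 1ℚ :- d) := f :- d :* f) refl (F u N) d ⟩
    F u N - d * F u N         ≤⟨ +-monoˡ-≤ (ℚ.- (d * F u N)) (Fu≤Fv+dFu N) ⟩
    F v N + d * F u N - d * F u N  ≡⟨ solve 3 (λ g d f → (g :+ d :* f) :- d :* f := g) refl (F v N) d (F u N) ⟩
    F v N                     ∎
    where
    open ≤-Reasoning
    F = expPartial
    u = v + d
    Fu≤Fv+dFu : ∀ N → F u N ≤ F v N + d * F u N
    Fu≤Fv+dFu zero    = ≤-+ʳ (0≤* 0≤d (≤ᵇ⇒≤ _))
    Fu≤Fv+dFu (suc N) = ≤-trans (expPartial-shift′ 0≤v 0≤d N)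
      (+-monoʳ-≤ (F v (suc N)) (*-mono-≤ˡ 0≤d (expPartial-≤-suc (+-mono-≤ 0≤v 0≤d) N)))

  expPartial-0 : ∀ N → expPartial 0ℚ N ≡ 1ℚ
  expPartial-0 zero    = refl
  expPartial-0 (suc N) = cong₂ _+_ (expPartial-0 N) (expTerm-0 N)
    where
    expTerm-0 : ∀ j → expTerm 0ℚ (suc j) ≡ 0ℚ
    expTerm-0 j = trans (cong (_* (+ 1 / suc j)) (*-zeroʳ (expTerm 0ℚ j))) (*-zeroˡ (+ 1 / suc j))

  module _ (m : ℕ) where

    private
      y : ℚ
      y = + 1 / suc m

      0≤y : 0ℚ ≤ y
      0≤y = 0≤1/ m

      ι[1+j]y≡ιjy+y : ∀ j → ι (suc j) * y ≡ ι j * y + y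
      ι[1+j]y≡ιjy+y j = trans (cong (_* y) (ι-suc j))
        (solve 2 (λ a y → (a :+ con 1ℚ) :* y := a :* y :+ y) refl (ι j) y)

      ιm≡[1-y]ι[1+m] : ι m ≡ (1ℚ - y) * ι (suc m)
      ιm≡[1-y]ι[1+m] = begin-equality
        ι m                          ≡⟨ solve 1 (λ a → a := (a :+ con 1ℚ) :- con 1ℚ) refl (ι m) ⟩
        ι m + 1ℚ - 1ℚ                ≡⟨ cong₂ _-_ (ι-suc m) (trans (*-comm y _) (ι*1/ι≡1 m)) ⟨
        ι (suc m) - y * ι (suc m)    ≡⟨ solve 2 (λ a y → a :- y :* a := (con 1ℚ :- y) :* a) refl (ι (suc m)) y ⟩
        (1ℚ - y) * ι (suc m)         ∎
        where open ≤-Reasoning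

    -- e^{j/(m+1)} ≤ ((m + 1)/m)ʲ: iterate expPartial-shift with d = 1/(m + 1), clearing denominators by mʲ.
    expPartial-bound : ∀ N j → expPartial (ι j * y) N * ι (m ℕ.^ j) ≤ ι (suc m ℕ.^ j)
    expPartial-bound N zero = ≤-reflexive (begin-equality
      F (ι 0 * y) N * 1ℚ   ≡⟨ cong (λ x → F x N * 1ℚ) (*-zeroˡ y) ⟩
      F 0ℚ N * 1ℚ          ≡⟨ cong (_* 1ℚ) (expPartial-0 N) ⟩
      1ℚ                   ∎)
      where
      open ≤-Reasoning
      F = expPartial
    expPartial-bound N (suc j) = begin
      F (ι (suc j) * y) N * ι (m ℕ.* m ℕ.^ j)
        ≡⟨ cong₂ (λ x z → F x N * z) (ι[1+j]y≡ιjy+y j) (trans (ι-* m (m ℕ.^ j)) (cong (_* R) ιm≡[1-y]ι[1+m])) ⟩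
      F (x + y) N * ((1ℚ - y) * M * R)
        ≡⟨ solve 4 (λ f q a b → f :* (q :* a :* b) := f :* q :* (a :* b)) refl (F (x + y) N) (1ℚ - y) M R ⟩
      F (x + y) N * (1ℚ - y) * (M * R)
        ≤⟨ *-mono-≤ʳ (0≤* (0≤ι (suc m)) (0≤ι (m ℕ.^ j))) (expPartial-shift (0≤* (0≤ι j) 0≤y) 0≤y N) ⟩
      F x N * (M * R)
        ≡⟨ solve 3 (λ f a b → f :* (a :* b) := a :* (f :* b)) refl (F x N) M R ⟩
      M * (F x N * R)
        ≤⟨ *-mono-≤ˡ (0≤ι (suc m)) (expPartial-bound N j) ⟩
      M * ι (suc m ℕ.^ j)
        ≡⟨ ι-* (suc m) (suc m ℕ.^ j) ⟨
      ι (suc m ℕ.^ suc j) ∎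
      where
      open ≤-Reasoning
      F = expPartial
      x = ι j * y
      M = ι (suc m)
      R = ι (m ℕ.^ j)

    ≤ln-intro : ∀ t k → .{{ℕ.NonZero m}} → suc m ℕ.^ (suc m ℕ.* t) ℕ.≤ k ℕ.* m ℕ.^ (suc m ℕ.* t) → ι t ≤ln k
    ≤ln-intro t k pow≤ = 0≤ι t , λ N → *-cancelʳ-≤-pos R {{R-pos}} (begin
      F (ι t) N * R                  ≡⟨ cong (λ x → F x N * R) ι[[1+m]t]y≡ιt ⟨
      F (ι j * y) N * R              ≤⟨ expPartial-bound N j ⟩
      ι (suc m ℕ.^ j)                ≤⟨ ι-mono-≤ pow≤ ⟩
      ι (k ℕ.* m ℕ.^ j)              ≡⟨ ι-* k (m ℕ.^ j) ⟩
      ι k * R                        ∎)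
      where
      open ≤-Reasoning
      F = expPartial
      j = suc m ℕ.* t
      R = ι (m ℕ.^ j)
      R-pos : ℚ.Positive R
      R-pos = ℚ.positive (<-≤-trans (ℚ.*<* (ℤ.+<+ (ℕ.s≤s ℕ.z≤n))) (ι-mono-≤ {1} {m ℕ.^ j} (ℕP.m^n>0 m j)))
      ι[[1+m]t]y≡ιt : ι j * y ≡ ι t
      ι[[1+m]t]y≡ιt = begin-equality
        ι j * y                  ≡⟨ cong (_* y) (ι-* (suc m) t) ⟩
        ι (suc m) * ι t * y      ≡⟨ solve 3 (λ a b y → a :* b :* y := b :* (a :* y)) refl (ι (suc m)) (ι t) y ⟩
        ι t * (ι (suc m) * y)    ≡⟨ cong (ι t *_) (ι*1/ι≡1 m) ⟩
        ι t * 1ℚ                 ≡⟨ *-identityʳ (ι t) ⟩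
        ι t                      ∎

  *ln-intro : ∀ c k {m t} → m ≡ c ℕ.* t → ι t ≤ln k → m ≤ c *ln k
  *ln-intro c k {t = t} refl t≤ln = ι t , t≤ln , ≤-reflexive (ι-* c t)

open import Data.Nat as ℕ
  using (ℕ; zero; suc; _+_; _*_; _∸_; _^_; _≤_; _<_; _!; z≤n; s≤s; s<s⁻¹; s≤s⁻¹; _≤?_; _<?_; NonZero)
open import Data.Nat.Properties hiding (_≟_; _<?_)
open import Data.Nat.ListAction using (sum)
open import Data.Nat.DivMod using (_/_; _%_; m≡m%n+[m/n]*n; m%n<n; m/n*n≤m)
open import Data.Nat.Solver using (module +-*-Solver)
open import Data.Fin as Fin using (Fin; zero; suc; toℕ; punchIn; punchOut; fromℕ<; combine; finToFun; funToFin; inject≤)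
open import Data.Fin.Properties
  using (_≟_; all?; ¬Fin0; punchInᵢ≢i; punchIn-injective; punchIn-punchOut; toℕ-injective; toℕ-fromℕ<; ¬∀⟶∃¬;
         combine-injective; combine-injectiveˡ; funToFin-finToFin; finToFun-funToFin; inject≤-injective)
open import Data.List as List using (List; []; _∷_; _++_; length; map; concatMap; allFin; filter; tabulate; lookup)
open import Data.List.Properties using (length-++; length-map; length-tabulate; filter-notAll)
open import Data.List.Membership.Propositional using (_∈_; _∉_; lose)
open import Data.List.Membership.Propositional.Properties
  using (∈-allFin; ∈-map⁺; ∈-map⁻; ∈-concatMap⁺; ∈-concatMap⁻; ∈-filter⁺; ∈-lookup)
open import Data.List.Relation.Unary.All as All using (All; []; _∷_)
import Data.List.Relation.Unary.All.Properties as All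
open import Data.List.Relation.Unary.Any as Any using (Any; here; there)
import Data.List.Relation.Unary.Any.Properties as Any
open import Data.List.Relation.Unary.AllPairs as AllPairs using (AllPairs; []; _∷_)
import Data.List.Relation.Unary.AllPairs.Properties as AllPairs
open import Data.List.Relation.Unary.Unique.Propositional using (Unique)
import Data.List.Relation.Unary.Unique.Propositional.Properties as Unique
open import Data.List.Extrema.Nat using (argmin; argmax; argmin-all; argmax-all; f[argmin]≤f[xs]; f[xs]≤f[argmax])
open import Data.Product using (∃; _×_; _,_; proj₁; proj₂)
open import Data.Unit using (tt)
open import Data.Empty using (⊥-elim)
open import Function.Base using (id; _∘_; _∘′_; _on_)
open import Function.Bundles using (Equivalence)
open import Function.Definitions using (Injective)
import Function.Properties.Equivalence as ⇔
open import Level using (Level)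
open import Relation.Nullary using (Dec; yes; no; ¬_; map′)
open import Relation.Nullary.Decidable using (_×-dec_; _⊎-dec_; _→-dec_; ¬?; decidable-stable)
open import Relation.Binary.Structures using (IsStrictTotalOrder)
open import Relation.Binary.Definitions using (Tri; tri<; tri≈; tri>)
open import Relation.Binary.PropositionalEquality
open import Algebra.Properties.CommutativeSemigroup +-commutativeSemigroup using (interchange)
open +-*-Solver
open ExponentialSeries using (≤ln-intro; *ln-intro)

private
  variable
    ℓ ℓ′ ℓ″ ℓ‴ : Level
    A : Set ℓ
    B : Set ℓ′
    P : Set ℓ″
    Q : Set ℓ‴

∑ : List A → (A → ℕ) → ℕ
∑ xs f = sum (map f xs)

syntax ∑ xs (λ x → e) = ∑[ x ∈ xs ] e

module _ {f g : A → ℕ} where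

  ∑-cong : ∀ xs → (∀ {x} → x ∈ xs → f x ≡ g x) → ∑ xs f ≡ ∑ xs g
  ∑-cong []       f≡g = refl
  ∑-cong (x ∷ xs) f≡g = cong₂ _+_ (f≡g (here refl)) (∑-cong xs (f≡g ∘′ there))

  ∑-mono-≤ : ∀ xs → (∀ {x} → x ∈ xs → f x ≤ g x) → ∑ xs f ≤ ∑ xs g
  ∑-mono-≤ []       f≤g = z≤n
  ∑-mono-≤ (x ∷ xs) f≤g = +-mono-≤ (f≤g (here refl)) (∑-mono-≤ xs (f≤g ∘′ there))

  ∑-mono-< : ∀ xs → (∀ {x} → x ∈ xs → f x ≤ g x) → ∀ {x} → x ∈ xs → f x < g x → ∑ xs f < ∑ xs g
  ∑-mono-< (y ∷ ys) f≤g (here refl) fx<gx = +-mono-<-≤ fx<gx (∑-mono-≤ ys (f≤g ∘′ there))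
  ∑-mono-< (y ∷ ys) f≤g (there x∈) fx<gx = +-mono-≤-< (f≤g (here refl)) (∑-mono-< ys (f≤g ∘′ there) x∈ fx<gx)

  ∑-distrib-+ : ∀ xs → ∑[ x ∈ xs ] (f x + g x) ≡ ∑ xs f + ∑ xs g
  ∑-distrib-+ []       = refl
  ∑-distrib-+ (x ∷ xs) = trans (cong (f x + g x +_) (∑-distrib-+ xs)) (interchange (f x) (g x) _ _)

∑-const : ∀ (xs : List A) c → ∑[ x ∈ xs ] c ≡ length xs * c
∑-const []       c = refl
∑-const (x ∷ xs) c = cong (c +_) (∑-const xs c)

∑-distribˡ-* : ∀ c (f : A → ℕ) xs → ∑[ x ∈ xs ] (c * f x) ≡ c * ∑ xs f
∑-distribˡ-* c f []       = sym (*-zeroʳ c)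
∑-distribˡ-* c f (x ∷ xs) = trans (cong (c * f x +_) (∑-distribˡ-* c f xs)) (sym (*-distribˡ-+ c (f x) _))

∑-distribʳ-* : ∀ c (f : A → ℕ) xs → ∑[ x ∈ xs ] (f x * c) ≡ ∑ xs f * c
∑-distribʳ-* c f []       = refl
∑-distribʳ-* c f (x ∷ xs) = trans (cong (f x * c +_) (∑-distribʳ-* c f xs)) (sym (*-distribʳ-+ c (f x) _))

∑-comm : ∀ (g : A → B → ℕ) xs ys → ∑[ x ∈ xs ] ∑ ys (g x) ≡ ∑[ y ∈ ys ] ∑[ x ∈ xs ] g x y
∑-comm g []       ys = sym (trans (∑-const ys 0) (*-zeroʳ (length ys)))
∑-comm g (x ∷ xs) ys = trans (cong (∑ ys (g x) +_) (∑-comm g xs ys)) (sym (∑-distrib-+ ys))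

∑-++ : ∀ (f : A → ℕ) xs ys → ∑ (xs ++ ys) f ≡ ∑ xs f + ∑ ys f
∑-++ f []       ys = refl
∑-++ f (x ∷ xs) ys = trans (cong (f x +_) (∑-++ f xs ys)) (sym (+-assoc (f x) _ _))

length-concatMap : ∀ (g : A → List B) xs → length (concatMap g xs) ≡ ∑[ x ∈ xs ] length (g x)
length-concatMap g []       = refl
length-concatMap g (x ∷ xs) = trans (length-++ (g x)) (cong (length (g x) +_) (length-concatMap g xs))

∑-concatMap : ∀ (f : B → ℕ) (g : A → List B) xs → ∑ (concatMap g xs) f ≡ ∑[ x ∈ xs ] ∑ (g x) f
∑-concatMap f g []       = refl
∑-concatMap f g (x ∷ xs) = trans (∑-++ f (g x) (concatMap g xs)) (cong (∑ (g x) f +_) (∑-concatMap f g xs))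

≤-∑ : ∀ (f : A → ℕ) {x xs} → x ∈ xs → f x ≤ ∑ xs f
≤-∑ f {xs = y ∷ ys} (here refl) = m≤m+n (f y) _
≤-∑ f {xs = y ∷ ys} (there x∈)  = ≤-trans (≤-∑ f x∈) (m≤n+m _ (f y))

*-argmin≤∑ : ∀ (f : A → ℕ) ⊤ xs → length xs * f (argmin f ⊤ xs) ≤ ∑ xs f
*-argmin≤∑ f ⊤ xs = begin
  length xs * f (argmin f ⊤ xs)  ≡⟨ ∑-const xs _ ⟨
  ∑[ x ∈ xs ] f (argmin f ⊤ xs)  ≤⟨ ∑-mono-≤ xs (All.lookup (f[argmin]≤f[xs] ⊤ xs)) ⟩
  ∑ xs f                         ∎
  where open ≤-Reasoning

∑≤*-argmax : ∀ (f : A → ℕ) ⊥ xs → ∑ xs f ≤ length xs * f (argmax f ⊥ xs)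
∑≤*-argmax f ⊥ xs = begin
  ∑ xs f                         ≤⟨ ∑-mono-≤ xs (All.lookup (f[xs]≤f[argmax] ⊥ xs)) ⟩
  ∑[ x ∈ xs ] f (argmax f ⊥ xs)  ≡⟨ ∑-const xs _ ⟩
  length xs * f (argmax f ⊥ xs)  ∎
  where open ≤-Reasoning

𝟙 : Dec P → ℕ
𝟙 (yes _) = 1
𝟙 (no _)  = 0

𝟙-yes : P → (P? : Dec P) → 𝟙 P? ≡ 1
𝟙-yes p (yes _) = refl
𝟙-yes p (no ¬p) = ⊥-elim (¬p p)

𝟙-no : ¬ P → (P? : Dec P) → 𝟙 P? ≡ 0
𝟙-no ¬p (yes p) = ⊥-elim (¬p p)
𝟙-no ¬p (no _)  = refl

𝟙≤1 : (P? : Dec P) → 𝟙 P? ≤ 1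
𝟙≤1 (yes _) = ≤-refl
𝟙≤1 (no _)  = z≤n

𝟙-cong : (P → Q) → (Q → P) → (P? : Dec P) (Q? : Dec Q) → 𝟙 P? ≡ 𝟙 Q?
𝟙-cong P→Q Q→P (yes p) Q? = sym (𝟙-yes (P→Q p) Q?)
𝟙-cong P→Q Q→P (no ¬p) Q? = sym (𝟙-no (¬p ∘′ Q→P) Q?)

𝟙-⊎ : ¬ (P × Q) → (P? : Dec P) (Q? : Dec Q) → 𝟙 (P? ⊎-dec Q?) ≡ 𝟙 P? + 𝟙 Q?
𝟙-⊎ ¬p×q (yes p) (yes q) = ⊥-elim (¬p×q (p , q))
𝟙-⊎ _    (yes _) (no _)  = refl
𝟙-⊎ _    (no _)  (yes _) = refl
𝟙-⊎ _    (no _)  (no _)  = refl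

𝟙-split : (P? : Dec P) (Q? : Dec Q) → 𝟙 (P? ×-dec ¬? Q?) + 𝟙 (P? ×-dec Q?) ≡ 𝟙 P?
𝟙-split (yes _) (yes _) = refl
𝟙-split (yes _) (no _)  = refl
𝟙-split (no _)  _       = refl

consPerm : ∀ {k} → Fin (suc k) → (Fin k → Fin k) → Fin (suc k) → Fin (suc k)
consPerm i π zero    = i
consPerm i π (suc x) = punchIn i (π x)

permutations : ∀ k → List (Fin k → Fin k)
permutations zero    = id ∷ []
permutations (suc k) = concatMap (λ i → map (consPerm i) (permutations k)) (allFin (suc k))

length-permutations : ∀ k → length (permutations k) ≡ k !
length-permutations zero    = refl
length-permutations (suc k) = begin
  length (permutations (suc k))
    ≡⟨ length-concatMap (λ i → map (consPerm i) (permutations k)) (allFin (suc k)) ⟩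
  ∑[ i ∈ allFin (suc k) ] length (map (consPerm i) (permutations k))
    ≡⟨ ∑-cong (allFin (suc k)) (λ {i} _ → trans (length-map (consPerm i) (permutations k)) (length-permutations k)) ⟩
  ∑[ i ∈ allFin (suc k) ] (k !)                                ≡⟨ ∑-const (allFin (suc k)) (k !) ⟩
  length (allFin (suc k)) * k !                                ≡⟨ cong (_* k !) (length-tabulate {n = suc k} id) ⟩
  suc k * k !                                                  ∎
  where open ≡-Reasoning

∈-permutations⁻ : ∀ {k π} → π ∈ permutations (suc k) →
                  ∃ λ i → ∃ λ σ → σ ∈ permutations k × π ≡ consPerm i σ
∈-permutations⁻ {k} π∈ with Any.satisfied (∈-concatMap⁻ _ {xs = allFin (suc k)} π∈)
... | i , π∈′ with ∈-map⁻ (consPerm i) π∈′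
...   | σ , σ∈ , refl = i , σ , σ∈ , refl

permutation-injective : ∀ {k π} → π ∈ permutations k → Injective _≡_ _≡_ π
permutation-injective {zero}  _  {x} = ⊥-elim (¬Fin0 x)
permutation-injective {suc k} π∈ with ∈-permutations⁻ π∈
... | i , σ , σ∈ , refl = injective
  where
  injective : Injective _≡_ _≡_ (consPerm i σ)
  injective {zero}  {zero}  _  = refl
  injective {zero}  {suc y} eq = ⊥-elim (punchInᵢ≢i i (σ y) (sym eq))
  injective {suc x} {zero}  eq = ⊥-elim (punchInᵢ≢i i (σ x) eq)
  injective {suc x} {suc y} eq = cong suc (permutation-injective σ∈ (punchIn-injective i (σ x) (σ y) eq))

permutation-surjective : ∀ {k π} → π ∈ permutations k → ∀ y → ∃ λ x → π x ≡ y
permutation-surjective {suc k} π∈ y with ∈-permutations⁻ π∈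
... | i , σ , σ∈ , refl with i ≟ y
...   | yes i≡y = zero , i≡y
...   | no i≢y with permutation-surjective σ∈ (punchOut i≢y)
...     | x , σx≡ = suc x , trans (cong (punchIn i) σx≡) (punchIn-punchOut i≢y)

∈-permutations⁺ : ∀ {k σ} i → σ ∈ permutations k → consPerm i σ ∈ permutations (suc k)
∈-permutations⁺ {k} i σ∈ = ∈-concatMap⁺ _ (lose (∈-allFin i) (∈-map⁺ (consPerm i) σ∈))

sorting-permutation : ∀ {k} (g : Fin k → ℕ) → Injective _≡_ _≡_ g →
       ∃ λ π → π ∈ permutations k × ConsistentWith (_<_ on g) π
sorting-permutation {zero}  g _     = id , here refl , λ ()
sorting-permutation {suc k} g g-inj = consPerm i σ , ∈-permutations⁺ i σ∈ , increasing
  where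
  i = argmin g zero (allFin (suc k))
  i-minimal : ∀ j → g i ≤ g j
  i-minimal j = All.lookup (f[argmin]≤f[xs] {f = g} zero (allFin (suc k))) (∈-allFin j)
  sorted : ∃ λ σ → σ ∈ permutations k × ConsistentWith (_<_ on (g ∘′ punchIn i)) σ
  sorted = sorting-permutation (g ∘′ punchIn i) (λ {x} {y} eq → punchIn-injective i x y (g-inj eq))
  σ = proj₁ sorted
  σ∈ = proj₁ (proj₂ sorted)
  increasing : ConsistentWith (_<_ on g) (consPerm i σ)
  increasing zero    (suc y) _         = ≤∧≢⇒< (i-minimal _) (λ eq → punchInᵢ≢i i (σ y) (sym (g-inj eq)))
  increasing (suc x) (suc y) (s≤s x<y) = proj₂ (proj₂ sorted) x y x<y

on-injective-isLinearOrder : ∀ {n} (ρ : Fin n → ℕ) → Injective _≡_ _≡_ ρ → IsLinearOrder (_<_ on ρ)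
on-injective-isLinearOrder ρ ρ-inj = record
  { isStrictPartialOrder = record
    { isEquivalence = isEquivalence
    ; irrefl        = λ { refl → <-irrefl refl }
    ; trans         = <-trans
    ; <-resp-≈      = (λ { refl → id }) , (λ { refl → id })
    }
  ; compare = compare
  }
  where
  compare : ∀ x y → Tri (ρ x < ρ y) (x ≡ y) (ρ y < ρ x)
  compare x y with <-cmp (ρ x) (ρ y)
  ... | tri< lt ≢ ≯ = tri< lt (≢ ∘′ cong ρ) ≯
  ... | tri≈ ≮ eq ≯ = tri≈ ≮ (ρ-inj eq) ≯
  ... | tri> ≮ ≢ gt = tri> ≮ (≢ ∘′ cong ρ) gt

module Rank {n} {_≺_ : Fin n → Fin n → Set} (≺-linear : IsLinearOrder _≺_) where
  open IsStrictTotalOrder ≺-linear using (compare) renaming (_<?_ to _≺?_; trans to ≺-trans; irrefl to ≺-irrefl)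

  rank : Fin n → ℕ
  rank x = ∑[ y ∈ allFin n ] 𝟙 (y ≺? x)

  private
    𝟙[x≺?x]<1 : ∀ x → 𝟙 (x ≺? x) < 1
    𝟙[x≺?x]<1 x = ≤-reflexive (cong suc (𝟙-no (≺-irrefl refl) (x ≺? x)))

  rank<n : ∀ x → rank x < n
  rank<n x = begin-strict
    rank x                     <⟨ ∑-mono-< (allFin n) (λ {y} _ → 𝟙≤1 (y ≺? x)) (∈-allFin x) (𝟙[x≺?x]<1 x) ⟩
    ∑[ y ∈ allFin n ] 1        ≡⟨ ∑-const (allFin n) 1 ⟩
    length (allFin n) * 1      ≡⟨ trans (*-identityʳ _) (length-tabulate id) ⟩
    n                          ∎
    where open ≤-Reasoning

  rank-mono-< : ∀ {x y} → x ≺ y → rank x < rank y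
  rank-mono-< {x} {y} x≺y = ∑-mono-< (allFin n) 𝟙-mono (∈-allFin x)
    (≤-trans (𝟙[x≺?x]<1 x) (≤-reflexive (sym (𝟙-yes x≺y (x ≺? y)))))
    where
    𝟙-mono : ∀ {z} → z ∈ allFin n → 𝟙 (z ≺? x) ≤ 𝟙 (z ≺? y)
    𝟙-mono {z} _ with z ≺? x
    ... | yes z≺x = ≤-reflexive (sym (𝟙-yes (≺-trans z≺x x≺y) (z ≺? y)))
    ... | no _    = z≤n

  rank-injective : Injective _≡_ _≡_ rank
  rank-injective {x} {y} eq with compare x y
  ... | tri< x≺y _ _ = ⊥-elim (<-irrefl eq (rank-mono-< x≺y))
  ... | tri≈ _ x≡y _ = x≡y
  ... | tri> _ _ y≺x = ⊥-elim (<-irrefl (sym eq) (rank-mono-< y≺x))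

  rank-cancel-< : ∀ {x y} → rank x < rank y → x ≺ y
  rank-cancel-< {x} {y} lt with compare x y
  ... | tri< x≺y _ _    = x≺y
  ... | tri≈ _ refl _   = ⊥-elim (<-irrefl refl lt)
  ... | tri> _ _ y≺x    = ⊥-elim (<-asym lt (rank-mono-< y≺x))

-- The lower bound

-- An item (w , s) is an edge whose still unplaced vertices are s, in order. If the unplaced vertices
-- rem are ordered at random, s ends up increasing with probability 1/|s|!, so by Valid the potential Φ
-- is at least K times the expected number of consistent edges; placing a random v ∈ rem below all
-- the others (reveal v) keeps Φ on average (∑-reveal).
module Avoidance {n : ℕ} (K : ℕ) where
  open import Data.List.Membership.DecPropositional (_≟_ {n}) using (_∈?_)

  Item : Set
  Item = ℕ × List (Fin n)

  Φ : List Item → ℕ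
  Φ items = ∑ items proj₁

  Valid : List (Fin n) → Item → Set
  Valid rem (w , s) = All (_∈ rem) s × Unique s × K ≤ w * length s !

  Increasing : (Fin n → ℕ) → List (Fin n) → Set
  Increasing ρ = AllPairs (_<_ on ρ)

  reveal : Fin n → Item → List Item
  reveal v (w , [])    = (w , []) ∷ []
  reveal v (w , x ∷ s) with v ≟ x | v ∈? s
  ... | yes _ | _     = (length (x ∷ s) * w , s) ∷ []
  ... | no _  | yes _ = []
  ... | no _  | no _  = (w , x ∷ s) ∷ []

  ∑-𝟙-≟ : ∀ {x : Fin n} {rem} → x ∈ rem → Unique rem → ∑[ v ∈ rem ] 𝟙 (v ≟ x) ≡ 1
  ∑-𝟙-≟ {x} {y ∷ ys} (here refl) (x≢ys ∷ _) =
    cong₂ _+_ (𝟙-yes refl (x ≟ x))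
      (trans (∑-cong ys (λ {v} v∈ → 𝟙-no (λ { refl → All.lookup x≢ys v∈ refl }) (v ≟ x)))
             (trans (∑-const ys 0) (*-zeroʳ (length ys))))
  ∑-𝟙-≟ {x} {y ∷ ys} (there x∈) (y≢ys ∷ u) =
    cong₂ _+_ (𝟙-no (λ { refl → All.lookup y≢ys x∈ refl }) (y ≟ x)) (∑-𝟙-≟ x∈ u)

  ∑-𝟙-∈ : ∀ {rem : List (Fin n)} s → Unique rem → Unique s → All (_∈ rem) s → ∑[ v ∈ rem ] 𝟙 (v ∈? s) ≡ length s
  ∑-𝟙-∈ {rem} []      _ _ _ =
    trans (∑-cong rem (λ {v} _ → 𝟙-no (λ ()) (v ∈? []))) (trans (∑-const rem 0) (*-zeroʳ (length rem)))
  ∑-𝟙-∈ {rem} (x ∷ s) u (x≢s ∷ us) (x∈ ∷ s⊆) = begin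
    ∑[ v ∈ rem ] 𝟙 (v ∈? x ∷ s)                  ≡⟨ ∑-cong rem (λ {v} _ → split v) ⟩
    ∑[ v ∈ rem ] (𝟙 (v ≟ x) + 𝟙 (v ∈? s))       ≡⟨ ∑-distrib-+ rem ⟩
    ∑[ v ∈ rem ] 𝟙 (v ≟ x) + ∑[ v ∈ rem ] 𝟙 (v ∈? s)  ≡⟨ cong₂ _+_ (∑-𝟙-≟ x∈ u) (∑-𝟙-∈ s u us s⊆) ⟩
    suc (length s)                               ∎
    where
    open ≡-Reasoning
    split : ∀ v → 𝟙 (v ∈? x ∷ s) ≡ 𝟙 (v ≟ x) + 𝟙 (v ∈? s)
    split v = trans (𝟙-cong Any.toSum Any.fromSum (v ∈? x ∷ s) (v ≟ x ⊎-dec v ∈? s))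
                    (𝟙-⊎ (λ { (refl , v∈s) → All.lookup x≢s v∈s refl }) (v ≟ x) (v ∈? s))

  private
    reveal-weight : ∀ v w x s → x ∉ s →
      Φ (reveal v (w , x ∷ s)) + (𝟙 (v ≟ x) + 𝟙 (v ∈? s)) * w ≡ w + 𝟙 (v ≟ x) * (length (x ∷ s) * w)
    reveal-weight v w x s x∉s with v ≟ x | v ∈? s
    ... | yes refl | yes v∈s = ⊥-elim (x∉s v∈s)
    ... | yes refl | no _    = solve 2 (λ l w → ((w :+ l :* w) :+ con 0) :+ (con 1 :+ con 0) :* w
                                                := w :+ con 1 :* (w :+ l :* w)) refl (length s) w
    ... | no _     | yes _   = refl
    ... | no _     | no _    = +-identityʳ (w + 0)

  ∑-reveal : ∀ {rem} → Unique rem → ∀ {it} → Valid rem it → ∑[ v ∈ rem ] Φ (reveal v it) ≡ length rem * proj₁ it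
  ∑-reveal {rem} u {w , []}    _ = trans (∑-cong rem (λ _ → +-identityʳ w)) (∑-const rem w)
  ∑-reveal {rem} u {w , x ∷ s} (x∈ ∷ s⊆ , x≢s ∷ us , _) = +-cancelʳ-≡ (length (x ∷ s) * w) _ _ (begin
    S + length (x ∷ s) * w
      ≡⟨ cong (λ c → S + c * w) (cong₂ _+_ (∑-𝟙-≟ x∈ u) (∑-𝟙-∈ s u us s⊆)) ⟨
    S + (∑[ v ∈ rem ] 𝟙 (v ≟ x) + ∑[ v ∈ rem ] 𝟙 (v ∈? s)) * w
      ≡⟨ cong (λ c → S + c * w) (∑-distrib-+ rem) ⟨
    S + ∑[ v ∈ rem ] (𝟙 (v ≟ x) + 𝟙 (v ∈? s)) * w
      ≡⟨ cong (S +_) (∑-distribʳ-* w _ rem) ⟨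
    S + ∑[ v ∈ rem ] ((𝟙 (v ≟ x) + 𝟙 (v ∈? s)) * w)
      ≡⟨ ∑-distrib-+ rem ⟨
    ∑[ v ∈ rem ] (Φ (reveal v (w , x ∷ s)) + (𝟙 (v ≟ x) + 𝟙 (v ∈? s)) * w)
      ≡⟨ ∑-cong rem (λ {v} _ → reveal-weight v w x s (Unique.Unique[x∷xs]⇒x∉xs (x≢s ∷ us))) ⟩
    ∑[ v ∈ rem ] (w + 𝟙 (v ≟ x) * (length (x ∷ s) * w))
      ≡⟨ ∑-distrib-+ rem ⟩
    ∑[ v ∈ rem ] w + ∑[ v ∈ rem ] (𝟙 (v ≟ x) * (length (x ∷ s) * w))
      ≡⟨ cong₂ _+_ (∑-const rem w) (trans (∑-distribʳ-* _ _ rem) (cong (_* (length (x ∷ s) * w)) (∑-𝟙-≟ x∈ u))) ⟩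
    length rem * w + 1 * (length (x ∷ s) * w)
      ≡⟨ cong (length rem * w +_) (*-identityˡ _) ⟩
    length rem * w + length (x ∷ s) * w ∎)
    where
    open ≡-Reasoning
    S = ∑[ v ∈ rem ] Φ (reveal v (w , x ∷ s))

  private
    ∉-∷ : ∀ {v x} {s : List (Fin n)} → v ≢ x → v ∉ s → v ∉ x ∷ s
    ∉-∷ v≢x _   (here v≡x)  = v≢x v≡x
    ∉-∷ _   v∉s (there v∈s) = v∉s v∈s

  _∖_ : List (Fin n) → Fin n → List (Fin n)
  rem ∖ v = filter (λ x → ¬? (x ≟ v)) rem

  private
    ⊆-∖ : ∀ {rem s v} → All (_∈ rem) s → v ∉ s → All (_∈ rem ∖ v) s
    ⊆-∖ {v = v} s⊆ v∉s = All.tabulate λ {y} y∈s →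
      ∈-filter⁺ (λ x → ¬? (x ≟ v)) (All.lookup s⊆ y∈s) (λ { refl → v∉s y∈s })

  reveal-valid : ∀ {rem} v {it} → Valid rem it → All (Valid (rem ∖ v)) (reveal v it)
  reveal-valid v {w , []}    (_ , _ , K≤) = ([] , [] , K≤) ∷ []
  reveal-valid v {w , x ∷ s} (x∈ ∷ s⊆ , x≢s ∷ us , K≤) with v ≟ x | v ∈? s
  ... | yes refl | _       = (⊆-∖ s⊆ (Unique.Unique[x∷xs]⇒x∉xs (x≢s ∷ us)) , us , K≤′) ∷ []
    where
    K≤′ : K ≤ length (x ∷ s) * w * length s !
    K≤′ = ≤-trans K≤ (≤-reflexive (solve 3 (λ w l f → w :* ((con 1 :+ l) :* f) := (con 1 :+ l) :* w :* f)
                                           refl w (length s) (length s !)))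
  ... | no _     | yes _   = []
  ... | no v≢x   | no v∉s  = (⊆-∖ (x∈ ∷ s⊆) (∉-∷ v≢x v∉s) , x≢s ∷ us , K≤) ∷ []

  ∃-reveal-Φ≤ : ∀ r rs → Unique (r ∷ rs) → ∀ items → All (Valid (r ∷ rs)) items →
                ∃ λ v → v ∈ r ∷ rs × Φ (concatMap (reveal v) items) ≤ Φ items
  ∃-reveal-Φ≤ r rs u items valid = v , v∈rem , *-cancelˡ-≤ (length rem) (begin
    length rem * F v                                 ≤⟨ *-argmin≤∑ F r rem ⟩
    ∑ rem F                                          ≡⟨ ∑-cong rem (λ {v} _ → ∑-concatMap proj₁ (reveal v) items) ⟩
    ∑[ v ∈ rem ] ∑[ it ∈ items ] Φ (reveal v it)     ≡⟨ ∑-comm (λ v it → Φ (reveal v it)) rem items ⟩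
    ∑[ it ∈ items ] ∑[ v ∈ rem ] Φ (reveal v it)     ≡⟨ ∑-cong items (λ it∈ → ∑-reveal u (All.lookup valid it∈)) ⟩
    ∑[ it ∈ items ] (length rem * proj₁ it)          ≡⟨ ∑-distribˡ-* (length rem) proj₁ items ⟩
    length rem * Φ items                             ∎)
    where
    open ≤-Reasoning
    rem = r ∷ rs
    F : Fin n → ℕ
    F v = Φ (concatMap (reveal v) items)
    v = argmin F r rem
    v∈rem : v ∈ rem
    v∈rem = argmin-all F (here refl) (All.tabulate id)

  putFirst : Fin n → (Fin n → ℕ) → Fin n → ℕ
  putFirst v ρ x with x ≟ v
  ... | yes _ = 0
  ... | no _  = suc (ρ x)

  private
    putFirst-≡ : ∀ v ρ → putFirst v ρ v ≡ 0
    putFirst-≡ v ρ with v ≟ v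
    ... | yes _  = refl
    ... | no v≢v = ⊥-elim (v≢v refl)

    putFirst-≢ : ∀ {v x} ρ → x ≢ v → putFirst v ρ x ≡ suc (ρ x)
    putFirst-≢ {v} {x} ρ x≢v with x ≟ v
    ... | yes x≡v = ⊥-elim (x≢v x≡v)
    ... | no _    = refl

  putFirst-injective : ∀ v {ρ} → Injective _≡_ _≡_ ρ → Injective _≡_ _≡_ (putFirst v ρ)
  putFirst-injective v ρ-inj {x} {y} eq with x ≟ v | y ≟ v
  ... | yes x≡v | yes y≡v = trans x≡v (sym y≡v)
  ... | no _    | no _    = ρ-inj (suc-injective eq)

  Increasing-putFirst⁻ : ∀ {v ρ s} → v ∉ s → Increasing (putFirst v ρ) s → Increasing ρ s
  Increasing-putFirst⁻ {s = []}    _   []           = []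
  Increasing-putFirst⁻ {v} {ρ} {x ∷ s} v∉ (x<s ∷ inc) =
    All.tabulate (λ {y} y∈s → s<s⁻¹ (subst₂ _<_ (putFirst-≢ ρ (≢v (here refl))) (putFirst-≢ ρ (≢v (there y∈s)))
                                                  (All.lookup x<s y∈s)))
    ∷ Increasing-putFirst⁻ (v∉ ∘′ there) inc
    where
    ≢v : ∀ {y} → y ∈ x ∷ s → y ≢ v
    ≢v y∈ refl = v∉ y∈

  reveal-sound : ∀ {ρ v w s} → Unique s → All (λ it → ¬ Increasing ρ (proj₂ it)) (reveal v (w , s)) →
                 ¬ Increasing (putFirst v ρ) s
  reveal-sound {s = []} _ (¬inc ∷ []) _ = ¬inc []
  reveal-sound {ρ} {v} {w} {x ∷ s} (x≢s ∷ us) ¬incs inc with v ≟ x | v ∈? s | ¬incs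
  ... | yes refl | _       | ¬inc ∷ [] = ¬inc (Increasing-putFirst⁻ (Unique.Unique[x∷xs]⇒x∉xs (x≢s ∷ us)) (AllPairs.tail inc))
  ... | no _     | yes v∈s | _         = n≮0 (subst (putFirst v ρ x <_) (putFirst-≡ v ρ) (All.lookup (AllPairs.head inc) v∈s))
  ... | no v≢x   | no v∉s  | ¬inc ∷ [] = ¬inc (Increasing-putFirst⁻ (∉-∷ v≢x v∉s) inc)

  Avoiding : List Item → Set
  Avoiding items = ∃ λ ρ → Injective _≡_ _≡_ ρ × All (λ it → ¬ Increasing ρ (proj₂ it)) items

  Avoiding-reveal⁻ : ∀ {rem} v {items} → All (Valid rem) items → Avoiding (concatMap (reveal v) items) → Avoiding items
  Avoiding-reveal⁻ v valid (ρ , ρ-inj , ¬incs) =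
    putFirst v ρ , putFirst-injective v ρ-inj ,
    All.zipWith (λ { ((_ , u , _) , ¬incs′) → reveal-sound u ¬incs′ }) (valid , All.map⁻ (All.concat⁻ ¬incs))

  avoid : ∀ fuel rem → length rem ≤ fuel → Unique rem →
          ∀ items → All (Valid rem) items → Φ items < K → Avoiding items
  avoid _ [] _ _ items valid Φ<K = toℕ , toℕ-injective , All.tabulate λ it∈ → ⊥-elim (heavy it∈ (All.lookup valid it∈))
    where
    heavy : ∀ {it} → it ∈ items → ¬ Valid [] it
    heavy {w , []} it∈ (_ , _ , K≤w*1) =
      <-irrefl refl (<-≤-trans Φ<K (≤-trans (≤-trans K≤w*1 (≤-reflexive (*-identityʳ w))) (≤-∑ proj₁ it∈)))
    heavy {w , x ∷ s} _ (() ∷ _ , _)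
  avoid zero    (_ ∷ _) () _ _ _ _
  avoid (suc fuel) (r ∷ rs) len u items valid Φ<K = step (∃-reveal-Φ≤ r rs u items valid)
    where
    step : (∃ λ v → v ∈ r ∷ rs × Φ (concatMap (reveal v) items) ≤ Φ items) → Avoiding items
    step (v , v∈rem , Φ′≤Φ) = Avoiding-reveal⁻ v valid
      (avoid fuel ((r ∷ rs) ∖ v) len′ (Unique.filter⁺ (λ x → ¬? (x ≟ v)) u) (concatMap (reveal v) items)
             (All.concat⁺ (All.map⁺ (All.map (reveal-valid v) valid))) (≤-<-trans Φ′≤Φ Φ<K))
      where
      len′ : length ((r ∷ rs) ∖ v) ≤ fuel
      len′ = s≤s⁻¹ (<-≤-trans (filter-notAll (λ x → ¬? (x ≟ v)) (r ∷ rs) (Any.map (λ { refl v≢v → v≢v refl }) v∈rem))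
                               len)

k!≤numEdges : ∀ {k n} (H : OrientedKGraph k n) → PropertyO H → k ! ≤ numEdges H
k!≤numEdges {k} {n} H O with k ! ≤? numEdges H
... | yes k!≤m = k!≤m
... | no k!≰m  = ⊥-elim (All.tabulate⁻ (proj₂ (proj₂ avoiding)) i (AllPairs.tabulate⁺-< (λ {x} {y} → consistent x y)))
  where
  open Avoidance {n} (k !)
  items : List Item
  items = tabulate (λ i → 1 , tabulate (lookup (edges H) i))
  Φ-items : ∀ {m} (s : Fin m → List (Fin n)) → Φ (tabulate (λ i → 1 , s i)) ≡ m
  Φ-items {zero}  s = refl
  Φ-items {suc m} s = cong suc (Φ-items (s ∘′ suc))
  avoiding : Avoiding items
  avoiding = avoid n (allFin n) (≤-reflexive (length-tabulate id)) (Unique.allFin⁺ n) items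
    (All.tabulate⁺ λ i → All.tabulate⁺ (λ _ → ∈-allFin _) , Unique.tabulate⁺ (distinct H i) ,
                        ≤-reflexive (sym (trans (*-identityˡ _) (cong _! (length-tabulate (lookup (edges H) i))))))
    (subst (_< k !) (sym (Φ-items _)) (≰⇒> k!≰m))
  ρ = proj₁ avoiding
  found = O (_<_ on ρ) (on-injective-isLinearOrder ρ (proj₁ (proj₂ avoiding)))
  i = proj₁ found
  consistent = proj₂ found

-- The upper bound

funToFin-cong : ∀ {m n} {f g : Fin m → Fin n} → (∀ x → f x ≡ g x) → funToFin f ≡ funToFin g
funToFin-cong {zero}  _   = refl
funToFin-cong {suc m} f≗g = cong₂ combine (f≗g zero) (funToFin-cong (f≗g ∘ suc))

finToFun-injective : ∀ {m n} {i j : Fin (n ^ m)} → (∀ x → finToFun {n} {m} i x ≡ finToFun j x) → i ≡ j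
finToFun-injective {m} {n} {i} {j} eq = begin
  i                                ≡⟨ funToFin-finToFin {m} {n} i ⟨
  funToFin (finToFun {n} {m} i)    ≡⟨ funToFin-cong eq ⟩
  funToFin (finToFun {n} {m} j)    ≡⟨ funToFin-finToFin {m} {n} j ⟩
  j                                ∎
  where open ≡-Reasoning

AllPairs-lookup : ∀ {a ℓ} {A : Set a} {R : A → A → Set ℓ} → (∀ {x y} → R x y → R y x) →
                  ∀ {xs} → AllPairs R xs → ∀ i j → i ≢ j → R (lookup xs i) (lookup xs j)
AllPairs-lookup sym-R (_  ∷ _)  zero    zero    i≢j = ⊥-elim (i≢j refl)
AllPairs-lookup sym-R (Rx ∷ _)  zero    (suc j) _   = All.lookup Rx (∈-lookup j)
AllPairs-lookup sym-R (Rx ∷ _)  (suc i) zero    _   = sym-R (All.lookup Rx (∈-lookup i))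
AllPairs-lookup sym-R (_  ∷ Rs) (suc i) (suc j) i≢j = AllPairs-lookup sym-R Rs i j (i≢j ∘ cong suc)

module Construction (k a : ℕ) where

  n : ℕ
  n = k * a

  Transversal : Set
  Transversal = Fin k → Fin a

  edge : Transversal → (Fin k → Fin k) → OrderedKSet k n
  edge f π x = combine (π x) (f (π x))

  edge-injective : ∀ f {π} → Injective _≡_ _≡_ π → Injective _≡_ _≡_ (edge f π)
  edge-injective f π-inj eq = π-inj (combine-injectiveˡ _ _ _ _ eq)

  edge-≉ : ∀ {f g π σ} → (∀ c → ∃ λ x → π x ≡ c) → ¬ (∀ c → f c ≡ g c) →
           ¬ SameUnderlyingSet (edge f π) (edge g σ)
  edge-≉ {f} {g} {π} {σ} π-surj f≉g same with ¬∀⟶∃¬ k _ (λ c → f c ≟ g c) f≉g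
  ... | c , fc≢gc with π-surj c
  ...   | x , refl with Equivalence.to (same (edge f π x)) (x , refl)
  ...     | y , eq with combine-injective (σ y) (g (σ y)) (π x) (f (π x)) eq
  ...       | σy≡πx , gσy≡fπx = fc≢gc (sym (trans (cong g (sym σy≡πx)) gσy≡fπx))

  -- A code i stands for the map finToFun i : Fin n → Fin n; the injective ones rank the vertices.
  Code : Set
  Code = Fin (n ^ n)

  ranking : Code → Fin n → Fin n
  ranking = finToFun

  rank : Code → Fin n → ℕ
  rank i = toℕ ∘ ranking i

  Consistent : OrderedKSet k n → Code → Set
  Consistent e i = ConsistentWith (_<_ on rank i) e

  consistent? : ∀ e i → Dec (Consistent e i)
  consistent? e i = all? λ x → all? λ y → (x Fin.<? y) →-dec (rank i (e x) <? rank i (e y))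

  Avoids : List (OrderedKSet k n) → Code → Set
  Avoids E i = Injective _≡_ _≡_ (ranking i) × All (λ e → ¬ Consistent e i) E

  avoids? : ∀ E i → Dec (Avoids E i)
  avoids? E i = injective? ×-dec All.all? (λ e → ¬? (consistent? e i)) E
    where
    injective? : Dec (Injective _≡_ _≡_ (ranking i))
    injective? = map′ (λ inj {x} {y} → inj x y) (λ inj x y → inj {x} {y}) pointwise?
      where
      pointwise? : Dec (∀ x y → ranking i x ≡ ranking i y → x ≡ y)
      pointwise? = all? λ x → all? λ y → (ranking i x ≟ ranking i y) →-dec (x ≟ y)

  #avoiding : List (OrderedKSet k n) → ℕ
  #avoiding E = ∑[ i ∈ allFin (n ^ n) ] 𝟙 (avoids? E i)

  #avoiding-[]≤ : #avoiding [] ≤ n ^ n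
  #avoiding-[]≤ = begin
    #avoiding []                        ≤⟨ ∑-mono-≤ (allFin (n ^ n)) (λ {i} _ → 𝟙≤1 (avoids? [] i)) ⟩
    ∑[ i ∈ allFin (n ^ n) ] 1           ≡⟨ ∑-const (allFin (n ^ n)) 1 ⟩
    length (allFin (n ^ n)) * 1         ≡⟨ trans (*-identityʳ _) (length-tabulate id) ⟩
    n ^ n                               ∎
    where open ≤-Reasoning

  caught : List (OrderedKSet k n) → Transversal → (Fin k → Fin k) → ℕ
  caught E f π = ∑[ i ∈ allFin (n ^ n) ] 𝟙 (avoids? E i ×-dec consistent? (edge f π) i)

  #avoiding-∷ : ∀ E f π → #avoiding (edge f π ∷ E) + caught E f π ≡ #avoiding E
  #avoiding-∷ E f π = trans (sym (∑-distrib-+ (allFin (n ^ n)))) (∑-cong (allFin (n ^ n)) (λ {i} _ → pointwise i))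
    where
    e = edge f π
    pointwise : ∀ i → 𝟙 (avoids? (e ∷ E) i) + 𝟙 (avoids? E i ×-dec consistent? e i) ≡ 𝟙 (avoids? E i)
    pointwise i = trans (cong (_+ 𝟙 (avoids? E i ×-dec consistent? e i))
                           (𝟙-cong (λ { (inj , ¬c ∷ ¬cs) → ((λ {x} {y} → inj {x} {y}) , ¬cs) , ¬c })
                                   (λ { ((inj , ¬cs) , ¬c) → (λ {x} {y} → inj {x} {y}) , ¬c ∷ ¬cs })
                                   (avoids? (e ∷ E) i) (avoids? E i ×-dec ¬? (consistent? e i))))
                        (𝟙-split (avoids? E i) (consistent? e i))

  -- An injective ranking orders the k vertices of the transversal f along some permutation.
  #avoiding≤∑caught : ∀ E f → #avoiding E ≤ ∑[ π ∈ permutations k ] caught E f π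
  #avoiding≤∑caught E f = begin
    #avoiding E                                     ≤⟨ ∑-mono-≤ (allFin (n ^ n)) (λ {i} _ → caught-somewhere i) ⟩
    ∑[ i ∈ allFin (n ^ n) ] ∑[ π ∈ permutations k ] 𝟙 (avoids? E i ×-dec consistent? (edge f π) i)
                                                    ≡⟨ ∑-comm _ (allFin (n ^ n)) (permutations k) ⟩
    ∑[ π ∈ permutations k ] caught E f π            ∎
    where
    open ≤-Reasoning
    caught-somewhere : ∀ i → 𝟙 (avoids? E i) ≤ ∑[ π ∈ permutations k ] 𝟙 (avoids? E i ×-dec consistent? (edge f π) i)
    caught-somewhere i with avoids? E i
    ... | no _  = z≤n
    ... | yes avoids with sorting-permutation (λ x → rank i (combine x (f x)))
                                              (λ eq → combine-injectiveˡ _ _ _ _ (proj₁ avoids (toℕ-injective eq)))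
    ...   | π , π∈ , sorted = ≤-trans (≤-reflexive (sym (𝟙-yes (avoids , sorted) (catch π))))
                                      (≤-∑ (𝟙 ∘ catch) π∈)
      where
      catch : ∀ π → Dec (Avoids E i × Consistent (edge f π) i)
      catch π = yes avoids ×-dec consistent? (edge f π) i

  opaque
    best : List (OrderedKSet k n) → Transversal → Fin k → Fin k
    best E f = argmax (caught E f) id (permutations k)

    best-injective : ∀ E f → Injective _≡_ _≡_ (best E f)
    best-injective E f = argmax-all (caught E f) {P = Injective _≡_ _≡_} id (All.tabulate permutation-injective)

    best-surjective : ∀ E f y → ∃ λ x → best E f x ≡ y
    best-surjective E f = argmax-all (caught E f) {P = λ π → ∀ y → ∃ λ x → π x ≡ y} (λ y → y , refl)
                                     (All.tabulate permutation-surjective)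

    ∑caught≤*best : ∀ E f → ∑[ σ ∈ permutations k ] caught E f σ ≤ k ! * caught E f (best E f)
    ∑caught≤*best E f = ≤-trans (∑≤*-argmax (caught E f) id (permutations k))
                                (≤-reflexive (cong (_* caught E f (best E f)) (length-permutations k)))

  #avoiding-best : ∀ E f → k ! * #avoiding (edge f (best E f) ∷ E) ≤ (k ! ∸ 1) * #avoiding E
  #avoiding-best E f = +-cancelʳ-≤ before _ _ (begin
    K * after + before                 ≤⟨ +-monoʳ-≤ (K * after) (≤-trans (#avoiding≤∑caught E f) (∑caught≤*best E f)) ⟩
    K * after + K * caught E f π       ≡⟨ *-distribˡ-+ K after _ ⟨
    K * (after + caught E f π)         ≡⟨ cong (K *_) (#avoiding-∷ E f π) ⟩
    K * before                         ≡⟨ cong (_* before) (suc-pred K {{k !≢0}}) ⟨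
    suc (K ∸ 1) * before               ≡⟨ +-comm before _ ⟩
    (K ∸ 1) * before + before          ∎)
    where
    open ≤-Reasoning
    K = k !
    π = best E f
    after = #avoiding (edge f π ∷ E)
    before = #avoiding E

  orient : List Transversal → List (OrderedKSet k n)
  orient []       = []
  orient (f ∷ fs) = edge f (best (orient fs) f) ∷ orient fs

  #avoiding-orient : ∀ fs → (k !) ^ length fs * #avoiding (orient fs) ≤ (k ! ∸ 1) ^ length fs * n ^ n
  #avoiding-orient []       = *-monoʳ-≤ 1 #avoiding-[]≤
  #avoiding-orient (f ∷ fs) = begin
    K * K ^ l * #avoiding (e ∷ E)             ≡⟨ solve 3 (λ K P A → K :* P :* A := P :* (K :* A)) refl K (K ^ l) _ ⟩
    K ^ l * (K * #avoiding (e ∷ E))           ≤⟨ *-monoʳ-≤ (K ^ l) (#avoiding-best E f) ⟩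
    K ^ l * ((K ∸ 1) * #avoiding E)           ≡⟨ solve 3 (λ P L B → P :* (L :* B) := L :* (P :* B)) refl (K ^ l) (K ∸ 1) _ ⟩
    (K ∸ 1) * (K ^ l * #avoiding E)           ≤⟨ *-monoʳ-≤ (K ∸ 1) (#avoiding-orient fs) ⟩
    (K ∸ 1) * ((K ∸ 1) ^ l * n ^ n)           ≡⟨ *-assoc (K ∸ 1) _ _ ⟨
    (K ∸ 1) * (K ∸ 1) ^ l * n ^ n             ∎
    where
    open ≤-Reasoning
    K = k !
    l = length fs
    E = orient fs
    e = edge f (best E f)

  length-orient : ∀ fs → length (orient fs) ≡ length fs
  length-orient []       = refl
  length-orient (f ∷ fs) = cong suc (length-orient fs)

  orient-injective : ∀ fs → All (Injective _≡_ _≡_) (orient fs)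
  orient-injective []       = []
  orient-injective (f ∷ fs) = edge-injective f (best-injective (orient fs) f) ∷ orient-injective fs

  orient-All : ∀ {p} {P : OrderedKSet k n → Set p} fs → (∀ {g} σ → g ∈ fs → P (edge g σ)) → All P (orient fs)
  orient-All []       _     = []
  orient-All (f ∷ fs) P-edge = P-edge _ (here refl) ∷ orient-All fs (λ σ g∈ → P-edge σ (there g∈))

  orient-≉ : ∀ {fs} → AllPairs (λ f g → ¬ (∀ c → f c ≡ g c)) fs →
             AllPairs (λ e e′ → ¬ SameUnderlyingSet e e′) (orient fs)
  orient-≉ {[]}     []            = []
  orient-≉ {f ∷ fs} (f≉fs ∷ fs≉) =
    orient-All fs (λ σ g∈ → edge-≉ (best-surjective (orient fs) f) (All.lookup f≉fs g∈)) ∷ orient-≉ fs≉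

  module _ (m : ℕ) (m≤aᵏ : m ≤ a ^ k) where

    transversals : List Transversal
    transversals = tabulate (λ j → finToFun (inject≤ j m≤aᵏ))

    graph : OrientedKGraph k n
    graph = record
      { edges    = orient transversals
      ; distinct = λ i → All.lookup (orient-injective transversals) (∈-lookup i)
      ; oriented = AllPairs-lookup ≉-sym (orient-≉ (AllPairs.tabulate⁺ transversals-≉))
      }
      where
      ≉-sym : ∀ {e e′ : OrderedKSet k n} → ¬ SameUnderlyingSet e e′ → ¬ SameUnderlyingSet e′ e
      ≉-sym ≉ same = ≉ (λ x → ⇔.sym (same x))
      transversals-≉ : ∀ {i j} → i ≢ j → ¬ (∀ c → finToFun (inject≤ i m≤aᵏ) c ≡ finToFun (inject≤ j m≤aᵏ) c)
      transversals-≉ i≢j eq = i≢j (inject≤-injective m≤aᵏ m≤aᵏ _ _ (finToFun-injective eq))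

    numEdges-graph : numEdges graph ≡ m
    numEdges-graph = trans (length-orient transversals) (length-tabulate _)

    -- Were some code to avoid every edge, the count bound would give k!ᵐ ≤ (k! − 1)ᵐ nⁿ.
    graph-propertyO : (k ! ∸ 1) ^ m * n ^ n < (k !) ^ m → PropertyO graph
    graph-propertyO few _≺_ ≺-linear = Any.index consistent , λ x y x<y →
      rank-cancel-< (subst₂ _<_ (rank-i _) (rank-i _) (Any.lookup-index consistent x y x<y))
      where
      open Rank ≺-linear renaming (rank to ≺-rank)
      E = orient transversals
      i : Code
      i = funToFin (λ x → fromℕ< (rank<n x))
      rank-i : ∀ x → rank i x ≡ ≺-rank x
      rank-i x = trans (cong toℕ (finToFun-funToFin _ x)) (toℕ-fromℕ< (rank<n x))
      ranking-i-injective : Injective _≡_ _≡_ (ranking i)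
      ranking-i-injective eq = rank-injective (trans (sym (rank-i _)) (trans (cong toℕ eq) (rank-i _)))
      ¬avoids : ¬ Avoids E i
      ¬avoids avoids = <-irrefl refl (<-≤-trans few (begin
        (k !) ^ m                                      ≤⟨ m≤m*n ((k !) ^ m) (#avoiding E) {{ℕ.>-nonZero 1≤#}} ⟩
        (k !) ^ m * #avoiding E                        ≡⟨ cong (λ l → (k !) ^ l * #avoiding E) length-transversals ⟨
        (k !) ^ length transversals * #avoiding E      ≤⟨ #avoiding-orient transversals ⟩
        (k ! ∸ 1) ^ length transversals * n ^ n        ≡⟨ cong (λ l → (k ! ∸ 1) ^ l * n ^ n) length-transversals ⟩
        (k ! ∸ 1) ^ m * n ^ n                          ∎))
        where
        open ≤-Reasoning
        length-transversals : length transversals ≡ m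
        length-transversals = length-tabulate _
        1≤# : 1 ≤ #avoiding E
        1≤# = ≤-trans (≤-reflexive (sym (𝟙-yes avoids (avoids? E i)))) (≤-∑ (λ i → 𝟙 (avoids? E i)) (∈-allFin i))
      consistent : Any (λ e → Consistent e i) E
      consistent = Any.map (decidable-stable (consistent? _ i))
                           (All.¬All⇒Any¬ (λ e → ¬? (consistent? e i)) E (λ ¬cs → ¬avoids (ranking-i-injective , ¬cs)))

-- Numerical estimates

induction-from : ∀ {p} {P : ℕ → Set p} b → P b → (∀ k → b ≤ k → P k → P (suc k)) → ∀ k → b ≤ k → P k
induction-from {P = P} b P-b step k b≤k with m≤n⇒∃[o]m+o≡n b≤k
... | d , refl = from d
  where
  from : ∀ d → P (b + d)
  from zero    = subst P (sym (+-identityʳ b)) P-b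
  from (suc d) = subst P (sym (+-suc b d)) (step (b + d) (m≤m+n b d) (from d))

^-distribʳ-* : ∀ m n o → (m * n) ^ o ≡ m ^ o * n ^ o
^-distribʳ-* m n zero    = refl
^-distribʳ-* m n (suc o) = trans (cong (m * n *_) (^-distribʳ-* m n o))
  (solve 4 (λ m n a b → (m :* n) :* (a :* b) := (m :* a) :* (n :* b)) refl m n (m ^ o) (n ^ o))

^-cancelˡ-< : ∀ e {x y} → x ^ suc e < y ^ suc e → x < y
^-cancelˡ-< e x^e<y^e = ≰⇒> (λ y≤x → <⇒≱ x^e<y^e (^-monoˡ-≤ (suc e) y≤x))

binom₂ : ℕ → ℕ
binom₂ zero    = 0
binom₂ (suc i) = binom₂ i + i

2*binom₂+n≡n*n : ∀ i → 2 * binom₂ i + i ≡ i * i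
2*binom₂+n≡n*n zero    = refl
2*binom₂+n≡n*n (suc i) = begin
  2 * (binom₂ i + i) + suc i    ≡⟨ solve 2 (λ c i → con 2 :* (c :+ i) :+ (con 1 :+ i)
                                                   := (con 2 :* c :+ i) :+ (con 2 :* i :+ con 1)) refl (binom₂ i) i ⟩
  2 * binom₂ i + i + (2 * i + 1) ≡⟨ cong (_+ (2 * i + 1)) (2*binom₂+n≡n*n i) ⟩
  i * i + (2 * i + 1)            ≡⟨ solve 1 (λ i → i :* i :+ (con 2 :* i :+ con 1) := (con 1 :+ i) :* (con 1 :+ i)) refl i ⟩
  suc i * suc i                  ∎
  where open ≡-Reasoning

-- (1 + 1/x)ⁱ ≥ 1 + i/x + C(i,2)/x², multiplied through by x^{i+2}.
binomial-lower : ∀ x i → x ^ i * (x * x + i * x + binom₂ i) ≤ x * x * (x + 1) ^ i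
binomial-lower x zero    = ≤-reflexive (solve 1 (λ x → con 1 :* (x :* x :+ con 0 :* x :+ con 0) := x :* x :* con 1) refl x)
binomial-lower x (suc i) = begin
  x * x ^ i * (x * x + suc i * x + (binom₂ i + i))
    ≡⟨ solve 4 (λ x p c i → x :* p :* (x :* x :+ (con 1 :+ i) :* x :+ (c :+ i))
                         := p :* (x :* (x :* x :+ (con 1 :+ i) :* x :+ (c :+ i)))) refl x (x ^ i) (binom₂ i) i ⟩
  x ^ i * (x * (x * x + suc i * x + (binom₂ i + i)))
    ≤⟨ *-monoʳ-≤ (x ^ i) (m≤m+n _ (binom₂ i)) ⟩
  x ^ i * (x * (x * x + suc i * x + (binom₂ i + i)) + binom₂ i)
    ≡⟨ solve 4 (λ x p c i → p :* (x :* (x :* x :+ (con 1 :+ i) :* x :+ (c :+ i)) :+ c)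
                         := (x :+ con 1) :* (p :* (x :* x :+ i :* x :+ c))) refl x (x ^ i) (binom₂ i) i ⟩
  (x + 1) * (x ^ i * (x * x + i * x + binom₂ i))
    ≤⟨ *-monoʳ-≤ (x + 1) (binomial-lower x i) ⟩
  (x + 1) * (x * x * (x + 1) ^ i)
    ≡⟨ solve 3 (λ y x p → y :* (x :* x :* p) := x :* x :* (y :* p)) refl (x + 1) x ((x + 1) ^ i) ⟩
  x * x * ((x + 1) * (x + 1) ^ i) ∎
  where open ≤-Reasoning

-- With X = suc x: (1 + 1/X)^X ≥ 2 + (X − 1)/(2X) ≥ p/q as soon as q ≤ (5q − 2p) X.
[1+1/x]ˣ-lower : ∀ x p q r → 2 * p + r ≡ 5 * q → q ≤ r * suc x → p * suc x ^ suc x ≤ q * (suc x + 1) ^ suc x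
[1+1/x]ˣ-lower x p q r 2p+r≡5q q≤rX = *-cancelʳ-≤ _ _ (X * X) (begin
  p * X ^ X * (X * X)          ≡⟨ solve 3 (λ p a b → p :* a :* b := a :* (p :* b)) refl p (X ^ X) (X * X) ⟩
  X ^ X * (p * (X * X))        ≤⟨ *-monoʳ-≤ (X ^ X) pXX≤qT₃ ⟩
  X ^ X * (q * T₃)              ≡⟨ solve 3 (λ a q b → a :* (q :* b) := q :* (a :* b)) refl (X ^ X) q T₃ ⟩
  q * (X ^ X * T₃)              ≤⟨ *-monoʳ-≤ q (binomial-lower X X) ⟩
  q * (X * X * (X + 1) ^ X)    ≡⟨ solve 3 (λ q a b → q :* (a :* b) := q :* b :* a) refl q (X * X) ((X + 1) ^ X) ⟩
  q * (X + 1) ^ X * (X * X)    ∎)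
  where
  open ≤-Reasoning
  X = suc x
  T₃ = X * X + X * X + binom₂ X
  pXX≤qT₃ : p * (X * X) ≤ q * T₃
  pXX≤qT₃ = *-cancelˡ-≤ 2 (+-cancelʳ-≤ (q * X) _ _ (begin
    2 * (p * (X * X)) + q * X        ≤⟨ +-monoʳ-≤ (2 * (p * (X * X))) (*-monoˡ-≤ X q≤rX) ⟩
    2 * (p * (X * X)) + r * X * X    ≡⟨ trans (solve 3 (λ p r x → con 2 :* (p :* (x :* x)) :+ r :* x :* x
                                                             := (con 2 :* p :+ r) :* (x :* x)) refl p r X)
                                              (cong (_* (X * X)) 2p+r≡5q) ⟩
    5 * q * (X * X)                  ≡⟨ cong (λ y → 5 * q * y) (2*binom₂+n≡n*n X) ⟨
    5 * q * (2 * binom₂ X + X)       ≡⟨ solve 3 (λ q c x → con 5 :* q :* (con 2 :* c :+ x)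
                                                        := con 2 :* (q :* ((con 2 :* c :+ x) :+ (con 2 :* c :+ x) :+ c)) :+ q :* x)
                                               refl q (binom₂ X) X ⟩
    2 * (q * ((2 * binom₂ X + X) + (2 * binom₂ X + X) + binom₂ X)) + q * X
                                     ≡⟨ cong (λ y → 2 * (q * (y + y + binom₂ X)) + q * X) (2*binom₂+n≡n*n X) ⟩
    2 * (q * T₃) + q * X              ∎))

n≤n! : ∀ n → n ≤ n !
n≤n! zero    = z≤n
n≤n! (suc n) = ≤-trans (≤-reflexive (sym (*-identityʳ (suc n)))) (*-monoʳ-≤ (suc n) (1≤n! n))

factorial-upper : ∀ k → 10 ≤ k → 49 ^ k * k ! ≤ 3 * 20 ^ k * k ^ k
factorial-upper = induction-from 10 (≤ᵇ⇒≤ _ _ tt) step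
  where
  step : ∀ k → 10 ≤ k → 49 ^ k * k ! ≤ 3 * 20 ^ k * k ^ k → 49 ^ suc k * suc k ! ≤ 3 * 20 ^ suc k * suc k ^ suc k
  step k@(suc x) 10≤k ih = begin
    49 * 49 ^ k * (suc k * k !)
      ≡⟨ solve 3 (λ a s f → con 49 :* a :* (s :* f) := s :* con 49 :* (a :* f)) refl (49 ^ k) (suc k) (k !) ⟩
    suc k * 49 * (49 ^ k * k !)
      ≤⟨ *-monoʳ-≤ (suc k * 49) ih ⟩
    suc k * 49 * (3 * 20 ^ k * k ^ k)
      ≡⟨ solve 3 (λ s b p → s :* con 49 :* (con 3 :* b :* p) := con 3 :* b :* s :* (con 49 :* p)) refl (suc k) (20 ^ k) (k ^ k) ⟩
    3 * 20 ^ k * suc k * (49 * k ^ k)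
      ≤⟨ *-monoʳ-≤ (3 * 20 ^ k * suc k) [1+1/k]ᵏ≥49/20 ⟩
    3 * 20 ^ k * suc k * (20 * suc k ^ k)
      ≡⟨ solve 3 (λ b s p → con 3 :* b :* s :* (con 20 :* p) := con 3 :* (con 20 :* b) :* (s :* p)) refl (20 ^ k) (suc k) (suc k ^ k) ⟩
    3 * (20 * 20 ^ k) * (suc k * suc k ^ k) ∎
    where
    open ≤-Reasoning
    [1+1/k]ᵏ≥49/20 : 49 * k ^ k ≤ 20 * suc k ^ k
    [1+1/k]ᵏ≥49/20 = ≤-trans ([1+1/x]ˣ-lower x 49 20 2 refl (*-monoʳ-≤ 2 10≤k))
                             (≤-reflexive (cong (λ y → 20 * y ^ k) (+-comm k 1)))

[1-1/K]ᴷ≤5/12 : ∀ K → 6 ≤ K → 12 * (K ∸ 1) ^ K ≤ 5 * K ^ K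
[1-1/K]ᴷ≤5/12 (suc x@(suc x′)) 6≤K = begin
  12 * (x * x ^ x)                ≡⟨ solve 2 (λ x p → con 12 :* (x :* p) := x :* (con 12 :* p)) refl x (x ^ x) ⟩
  x * (12 * x ^ x)                ≤⟨ *-monoʳ-≤ x [1+1/x]ˣ≥12/5 ⟩
  x * (5 * suc x ^ x)             ≤⟨ *-monoˡ-≤ (5 * suc x ^ x) (n≤1+n x) ⟩
  suc x * (5 * suc x ^ x)         ≡⟨ solve 2 (λ s p → s :* (con 5 :* p) := con 5 :* (s :* p)) refl (suc x) (suc x ^ x) ⟩
  5 * (suc x * suc x ^ x)         ∎
  where
  open ≤-Reasoning
  [1+1/x]ˣ≥12/5 : 12 * x ^ x ≤ 5 * suc x ^ x
  [1+1/x]ˣ≥12/5 = ≤-trans ([1+1/x]ˣ-lower x′ 12 5 1 refl (subst (5 ≤_) (sym (*-identityˡ x)) (s≤s⁻¹ 6≤K)))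
                          (≤-reflexive (cong (λ y → 5 * y ^ x) (+-comm x 1)))
[1-1/K]ᴷ≤5/12 1 (s≤s ())

cubic≤exp : ∀ k → 1500 ≤ k → 3 * (k * k * k) * 240 ^ k ≤ 245 ^ k
cubic≤exp = induction-from 1500 (≤ᵇ⇒≤ _ _ tt) step
  where
  cube-step : ∀ k → 1500 ≤ k → 240 * (suc k * suc k * suc k) ≤ 245 * (k * k * k)
  cube-step k 1500≤k = begin
    240 * (suc k * suc k * suc k)
      ≡⟨ solve 1 (λ k → con 240 :* ((con 1 :+ k) :* (con 1 :+ k) :* (con 1 :+ k))
                     := con 240 :* (k :* k :* k) :+ (con 720 :* (k :* k) :+ con 720 :* k :+ con 240)) refl k ⟩
    240 * (k * k * k) + (720 * (k * k) + 720 * k + 240)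
      ≤⟨ +-monoʳ-≤ (240 * (k * k * k)) lower-order ⟩
    240 * (k * k * k) + 5 * (k * k * k)
      ≡⟨ solve 1 (λ c → con 240 :* c :+ con 5 :* c := con 245 :* c) refl (k * k * k) ⟩
    245 * (k * k * k) ∎
    where
    open ≤-Reasoning
    1≤k : 1 ≤ k
    1≤k = ≤-trans (s≤s z≤n) 1500≤k
    k≤kk : k ≤ k * k
    k≤kk = m≤m*n k k {{ℕ.>-nonZero 1≤k}}
    lower-order : 720 * (k * k) + 720 * k + 240 ≤ 5 * (k * k * k)
    lower-order = begin
      720 * (k * k) + 720 * k + 240
        ≤⟨ +-mono-≤ (+-monoʳ-≤ (720 * (k * k)) (*-monoʳ-≤ 720 k≤kk)) (*-monoʳ-≤ 240 (≤-trans 1≤k k≤kk)) ⟩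
      720 * (k * k) + 720 * (k * k) + 240 * (k * k)
        ≡⟨ solve 1 (λ s → con 720 :* s :+ con 720 :* s :+ con 240 :* s := con 1680 :* s) refl (k * k) ⟩
      1680 * (k * k)                            ≤⟨ *-monoˡ-≤ (k * k) (≤-trans (≤ᵇ⇒≤ 1680 7500 tt) (*-monoʳ-≤ 5 1500≤k)) ⟩
      5 * k * (k * k)                           ≡⟨ solve 1 (λ k → con 5 :* k :* (k :* k) := con 5 :* (k :* k :* k)) refl k ⟩
      5 * (k * k * k)                           ∎
  step : ∀ k → 1500 ≤ k → 3 * (k * k * k) * 240 ^ k ≤ 245 ^ k → 3 * (suc k * suc k * suc k) * 240 ^ suc k ≤ 245 ^ suc k
  step k 1500≤k ih = begin
    3 * (suc k * suc k * suc k) * (240 * 240 ^ k)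
      ≡⟨ solve 2 (λ c p → con 3 :* c :* (con 240 :* p) := con 240 :* c :* (con 3 :* p)) refl (suc k * suc k * suc k) (240 ^ k) ⟩
    240 * (suc k * suc k * suc k) * (3 * 240 ^ k)
      ≤⟨ *-monoˡ-≤ (3 * 240 ^ k) (cube-step k 1500≤k) ⟩
    245 * (k * k * k) * (3 * 240 ^ k)
      ≡⟨ solve 2 (λ c p → con 245 :* c :* (con 3 :* p) := con 245 :* (con 3 :* c :* p)) refl (k * k * k) (240 ^ k) ⟩
    245 * (3 * (k * k * k) * 240 ^ k)
      ≤⟨ *-monoʳ-≤ 245 ih ⟩
    245 * 245 ^ k ∎
    where open ≤-Reasoning

[20/19]¹⁰⁰ᵗ⁺¹²⁰≤[12/5]⁶ᵗ : ∀ t → 50 ≤ t → 20 ^ (20 * (5 * t + 6)) * 5 ^ (6 * t) ≤ 19 ^ (20 * (5 * t + 6)) * 12 ^ (6 * t)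
[20/19]¹⁰⁰ᵗ⁺¹²⁰≤[12/5]⁶ᵗ = induction-from 50 (≤ᵇ⇒≤ _ _ tt) step
  where
  step : ∀ t → 50 ≤ t → 20 ^ (20 * (5 * t + 6)) * 5 ^ (6 * t) ≤ 19 ^ (20 * (5 * t + 6)) * 12 ^ (6 * t) →
         20 ^ (20 * (5 * suc t + 6)) * 5 ^ (6 * suc t) ≤ 19 ^ (20 * (5 * suc t + 6)) * 12 ^ (6 * suc t)
  step t _ ih = begin
    20 ^ (20 * (5 * suc t + 6)) * 5 ^ (6 * suc t)    ≡⟨ cong₂ (λ a b → 20 ^ a * 5 ^ b) E-suc G-suc ⟩
    20 ^ (E + 100) * 5 ^ (G + 6)                     ≡⟨ split 20 5 ⟩
    (20 ^ E * 5 ^ G) * (20 ^ 100 * 5 ^ 6)            ≤⟨ *-mono-≤ ih (≤ᵇ⇒≤ _ _ tt) ⟩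
    (19 ^ E * 12 ^ G) * (19 ^ 100 * 12 ^ 6)          ≡⟨ split 19 12 ⟨
    19 ^ (E + 100) * 12 ^ (G + 6)                    ≡⟨ cong₂ (λ a b → 19 ^ a * 12 ^ b) E-suc G-suc ⟨
    19 ^ (20 * (5 * suc t + 6)) * 12 ^ (6 * suc t)   ∎
    where
    open ≤-Reasoning
    E = 20 * (5 * t + 6)
    G = 6 * t
    E-suc : 20 * (5 * suc t + 6) ≡ E + 100
    E-suc = solve 1 (λ t → con 20 :* (con 5 :* (con 1 :+ t) :+ con 6) := con 20 :* (con 5 :* t :+ con 6) :+ con 100) refl t
    G-suc : 6 * suc t ≡ G + 6
    G-suc = solve 1 (λ t → con 6 :* (con 1 :+ t) := con 6 :* t :+ con 6) refl t
    split : ∀ x y → x ^ (E + 100) * y ^ (G + 6) ≡ (x ^ E * y ^ G) * (x ^ 100 * y ^ 6)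
    split x y = trans (cong₂ _*_ (^-distribˡ-+-* x E 100) (^-distribˡ-+-* y G 6))
      (solve 4 (λ a b c d → a :* b :* (c :* d) := (a :* c) :* (b :* d)) refl (x ^ E) (x ^ 100) (y ^ G) (y ^ 6))

k²k!t≤aᵏ : ∀ k a t → 1500 ≤ k → t ≤ k → 5 * k ≤ 12 * a → k ^ 2 * k ! * t ≤ a ^ k
k²k!t≤aᵏ k a t 1500≤k t≤k 5k≤12a = *-cancelʳ-≤ _ _ W {{m*n≢0 (49 ^ k) (12 ^ k) {{m^n≢0 49 k}} {{m^n≢0 12 k}}}} (begin
  k ^ 2 * k ! * t * W                          ≡⟨ solve 6 (λ p f t a b c → p :* f :* t :* (a :* b) := (a :* f) :* (p :* t :* b))
                                                          refl (k ^ 2) (k !) t (49 ^ k) (12 ^ k) (k ^ k) ⟩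
  (49 ^ k * k !) * (k ^ 2 * t * 12 ^ k)        ≤⟨ *-mono-≤ (factorial-upper k (≤-trans (≤ᵇ⇒≤ 10 1500 tt) 1500≤k))
                                                           (*-monoˡ-≤ (12 ^ k) (*-monoʳ-≤ (k ^ 2) t≤k)) ⟩
  (3 * 20 ^ k * k ^ k) * (k ^ 2 * k * 12 ^ k)  ≡⟨ solve 4 (λ k a b c → (con 3 :* a :* b) :* (k :* (k :* con 1) :* k :* c)
                                                                   := con 3 :* (k :* k :* k) :* (a :* c) :* b)
                                                          refl k (20 ^ k) (k ^ k) (12 ^ k) ⟩
  3 * (k * k * k) * (20 ^ k * 12 ^ k) * k ^ k  ≡⟨ cong (λ z → 3 * (k * k * k) * z * k ^ k) (^-distribʳ-* 20 12 k) ⟨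
  3 * (k * k * k) * 240 ^ k * k ^ k            ≤⟨ *-monoˡ-≤ (k ^ k) (cubic≤exp k 1500≤k) ⟩
  245 ^ k * k ^ k                              ≡⟨ cong (_* k ^ k) (^-distribʳ-* 5 49 k) ⟩
  5 ^ k * 49 ^ k * k ^ k                       ≡⟨ solve 3 (λ a b c → a :* b :* c := (a :* c) :* b) refl (5 ^ k) (49 ^ k) (k ^ k) ⟩
  5 ^ k * k ^ k * 49 ^ k                       ≡⟨ cong (_* 49 ^ k) (^-distribʳ-* 5 k k) ⟨
  (5 * k) ^ k * 49 ^ k                         ≤⟨ *-monoˡ-≤ (49 ^ k) (^-monoˡ-≤ k 5k≤12a) ⟩
  (12 * a) ^ k * 49 ^ k                        ≡⟨ cong (_* 49 ^ k) (^-distribʳ-* 12 a k) ⟩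
  12 ^ k * a ^ k * 49 ^ k                      ≡⟨ solve 3 (λ a b c → a :* b :* c := b :* (c :* a)) refl (12 ^ k) (a ^ k) (49 ^ k) ⟩
  a ^ k * W                                    ∎)
  where
  open ≤-Reasoning
  W = 49 ^ k * 12 ^ k

-- Since (1 − 1/K)ᴷ ≤ 5/12, the factor (1 − 1/K)ᴷʲ beats nⁿ as soon as (12/5)ʲ does.
[K∸1]ᴷʲnⁿ<Kᴷʲ : ∀ K j n → 6 ≤ K → n ^ n * 5 ^ j < 12 ^ j → (K ∸ 1) ^ (K * j) * n ^ n < K ^ (K * j)
[K∸1]ᴷʲnⁿ<Kᴷʲ K j n 6≤K nⁿ5ʲ<12ʲ = *-cancelʳ-< (12 ^ j) _ _ (begin-strict
  (K ∸ 1) ^ (K * j) * n ^ n * 12 ^ j        ≡⟨ cong (λ z → z * n ^ n * 12 ^ j) (^-*-assoc (K ∸ 1) K j) ⟨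
  ((K ∸ 1) ^ K) ^ j * n ^ n * 12 ^ j        ≡⟨ solve 3 (λ a b c → a :* b :* c := c :* a :* b) refl (((K ∸ 1) ^ K) ^ j) (n ^ n) (12 ^ j) ⟩
  12 ^ j * ((K ∸ 1) ^ K) ^ j * n ^ n        ≡⟨ cong (_* n ^ n) (^-distribʳ-* 12 ((K ∸ 1) ^ K) j) ⟨
  (12 * (K ∸ 1) ^ K) ^ j * n ^ n            ≤⟨ *-monoˡ-≤ (n ^ n) (^-monoˡ-≤ j ([1-1/K]ᴷ≤5/12 K 6≤K)) ⟩
  (5 * K ^ K) ^ j * n ^ n                   ≡⟨ cong (_* n ^ n) (^-distribʳ-* 5 (K ^ K) j) ⟩
  5 ^ j * (K ^ K) ^ j * n ^ n               ≡⟨ solve 3 (λ a b c → a :* b :* c := b :* (c :* a)) refl (5 ^ j) ((K ^ K) ^ j) (n ^ n) ⟩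
  (K ^ K) ^ j * (n ^ n * 5 ^ j)             <⟨ *-monoʳ-< ((K ^ K) ^ j) {{Kᴷʲ≢0}} nⁿ5ʲ<12ʲ ⟩
  (K ^ K) ^ j * 12 ^ j                      ≡⟨ cong (_* 12 ^ j) (^-*-assoc K K j) ⟩
  K ^ (K * j) * 12 ^ j                      ∎)
  where
  open ≤-Reasoning
  Kᴷʲ≢0 : NonZero ((K ^ K) ^ j)
  Kᴷʲ≢0 = m^n≢0 (K ^ K) j {{m^n≢0 K K {{ℕ.>-nonZero (≤-trans (s≤s z≤n) 6≤K)}}}}

c*19ʸ<20ʸ⇒c*19ˣ<20ˣ : ∀ {c y x} → c * 19 ^ y < 20 ^ y → y ≤ x → c * 19 ^ x < 20 ^ x
c*19ʸ<20ʸ⇒c*19ˣ<20ˣ {c} {y} {x} lt y≤x with m≤n⇒∃[o]m+o≡n y≤x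
... | d , refl = begin-strict
  c * 19 ^ (y + d)            ≡⟨ cong (c *_) (^-distribˡ-+-* 19 y d) ⟩
  c * (19 ^ y * 19 ^ d)       ≡⟨ *-assoc c _ _ ⟨
  c * 19 ^ y * 19 ^ d         ≤⟨ *-monoʳ-≤ (c * 19 ^ y) (^-monoˡ-≤ d (≤ᵇ⇒≤ 19 20 tt)) ⟩
  c * 19 ^ y * 20 ^ d         <⟨ *-monoˡ-< (20 ^ d) {{m^n≢0 20 d}} lt ⟩
  20 ^ y * 20 ^ d             ≡⟨ ^-distribˡ-+-* 20 y d ⟨
  20 ^ (y + d)                ∎
  where open ≤-Reasoning

-- With 12 n ≤ 5k² + 11k and k < (20/19)^{20(t+1)}: n^{6n} ≤ k^{5k²+11k} < (20/19)^{20(5t+6)k²} ≤ (12/5)^{6k²t}.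
nⁿ5ᵏᵏᵗ<12ᵏᵏᵗ : ∀ k n t → 50 ≤ t → 11 * (t + 1) ≤ k → 12 * n ≤ 5 * (k * k) + 11 * k →
               k * 19 ^ (20 * (t + 1)) < 20 ^ (20 * (t + 1)) → n ^ n * 5 ^ (k * k * t) < 12 ^ (k * k * t)
nⁿ5ᵏᵏᵗ<12ᵏᵏᵗ k n t 50≤t 11[t+1]≤k 12n≤E k19ᵀ<20ᵀ = ^-cancelˡ-< 5 (*-cancelʳ-< (19 ^ X) _ _ (begin-strict
  (n ^ n * 5 ^ j) ^ 6 * 19 ^ X                ≡⟨ cong (_* 19 ^ X) (^-distribʳ-* (n ^ n) (5 ^ j) 6) ⟩
  (n ^ n) ^ 6 * (5 ^ j) ^ 6 * 19 ^ X          ≡⟨ cong₂ (λ a b → a * b * 19 ^ X) (^-*-assoc n n 6) (trans (^-*-assoc 5 j 6) (cong (5 ^_) 6j≡G)) ⟩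
  n ^ (n * 6) * 5 ^ G * 19 ^ X                ≡⟨ solve 3 (λ a b c → a :* b :* c := a :* c :* b) refl (n ^ (n * 6)) (5 ^ G) (19 ^ X) ⟩
  n ^ (n * 6) * 19 ^ X * 5 ^ G                <⟨ *-monoˡ-< (5 ^ G) {{m^n≢0 5 G}} n⁶ⁿ19ˣ<20ˣ ⟩
  20 ^ X * 5 ^ G                              ≤⟨ 20ˣ5ᴳ≤19ˣ12ᴳ ⟩
  19 ^ X * 12 ^ G                             ≡⟨ *-comm (19 ^ X) (12 ^ G) ⟩
  12 ^ G * 19 ^ X                             ≡⟨ cong (λ e → 12 ^ e * 19 ^ X) 6j≡G ⟨
  12 ^ (j * 6) * 19 ^ X                       ≡⟨ cong (_* 19 ^ X) (^-*-assoc 12 j 6) ⟨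
  (12 ^ j) ^ 6 * 19 ^ X                       ∎))
  where
  open ≤-Reasoning
  kk = k * k
  j = kk * t
  E = 5 * kk + 11 * k
  T = 20 * (t + 1)
  X = 20 * (5 * t + 6) * kk
  G = 6 * t * kk
  6j≡G : j * 6 ≡ G
  6j≡G = solve 2 (λ k t → k :* k :* t :* con 6 := con 6 :* t :* (k :* k)) refl k t
  11≤k : 11 ≤ k
  11≤k = ≤-trans (m≤m*n 11 (t + 1) {{subst NonZero (+-comm 1 t) _}}) 11[t+1]≤k
  1≤k : 1 ≤ k
  1≤k = ≤-trans (s≤s z≤n) 11≤k
  n≤kk : n ≤ kk
  n≤kk = *-cancelˡ-≤ 12 (begin
    12 * n              ≤⟨ 12n≤E ⟩
    5 * kk + 11 * k     ≤⟨ +-monoʳ-≤ (5 * kk) (*-monoˡ-≤ k 11≤k) ⟩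
    5 * kk + kk         ≤⟨ +-monoˡ-≤ kk (*-monoˡ-≤ kk (≤ᵇ⇒≤ 5 11 tt)) ⟩
    11 * kk + kk        ≡⟨ +-comm (11 * kk) kk ⟩
    12 * kk             ∎)
  n⁶ⁿ≤kᴱ : n ^ (n * 6) ≤ k ^ E
  n⁶ⁿ≤kᴱ = begin
    n ^ (n * 6)                   ≤⟨ ^-monoˡ-≤ (n * 6) n≤kk ⟩
    kk ^ (n * 6)                  ≡⟨ ^-distribʳ-* k k (n * 6) ⟩
    k ^ (n * 6) * k ^ (n * 6)     ≡⟨ ^-distribˡ-+-* k (n * 6) (n * 6) ⟨
    k ^ (n * 6 + n * 6)           ≡⟨ cong (k ^_) (solve 1 (λ n → n :* con 6 :+ n :* con 6 := con 12 :* n) refl n) ⟩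
    k ^ (12 * n)                  ≤⟨ ^-monoʳ-≤ k {{ℕ.>-nonZero 1≤k}} 12n≤E ⟩
    k ^ E                         ∎
  E≢0 : NonZero E
  E≢0 = ℕ.>-nonZero (≤-trans 1≤k (≤-trans (m≤n*m k 11) (m≤n+m (11 * k) (5 * kk))))
  kᴱ19ᵀᴱ<20ᵀᴱ : k ^ E * 19 ^ (T * E) < 20 ^ (T * E)
  kᴱ19ᵀᴱ<20ᵀᴱ = begin-strict
    k ^ E * 19 ^ (T * E)          ≡⟨ cong (k ^ E *_) (^-*-assoc 19 T E) ⟨
    k ^ E * (19 ^ T) ^ E          ≡⟨ ^-distribʳ-* k (19 ^ T) E ⟨
    (k * 19 ^ T) ^ E              <⟨ ^-monoˡ-< E {{E≢0}} k19ᵀ<20ᵀ ⟩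
    (20 ^ T) ^ E                  ≡⟨ ^-*-assoc 20 T E ⟩
    20 ^ (T * E)                  ∎
  TE≤X : T * E ≤ X
  TE≤X = begin
    T * E                                   ≡⟨ solve 2 (λ t k → con 20 :* (t :+ con 1) :* (con 5 :* (k :* k) :+ con 11 :* k)
                                                     := con 20 :* (con 5 :* (t :+ con 1) :* (k :* k) :+ con 11 :* (t :+ con 1) :* k)) refl t k ⟩
    20 * (5 * (t + 1) * kk + 11 * (t + 1) * k) ≤⟨ *-monoʳ-≤ 20 (+-monoʳ-≤ (5 * (t + 1) * kk) (*-monoˡ-≤ k 11[t+1]≤k)) ⟩
    20 * (5 * (t + 1) * kk + k * k)         ≡⟨ solve 2 (λ t k → con 20 :* (con 5 :* (t :+ con 1) :* (k :* k) :+ k :* k)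
                                                     := con 20 :* (con 5 :* t :+ con 6) :* (k :* k)) refl t k ⟩
    X                                       ∎
  n⁶ⁿ19ˣ<20ˣ : n ^ (n * 6) * 19 ^ X < 20 ^ X
  n⁶ⁿ19ˣ<20ˣ = c*19ʸ<20ʸ⇒c*19ˣ<20ˣ {n ^ (n * 6)} (≤-<-trans (*-monoˡ-≤ (19 ^ (T * E)) n⁶ⁿ≤kᴱ) kᴱ19ᵀᴱ<20ᵀᴱ)
                                                 TE≤X
  20ˣ5ᴳ≤19ˣ12ᴳ : 20 ^ X * 5 ^ G ≤ 19 ^ X * 12 ^ G
  20ˣ5ᴳ≤19ˣ12ᴳ = begin
    20 ^ X * 5 ^ G                                   ≡⟨ cong₂ _*_ (^-*-assoc 20 (20 * (5 * t + 6)) kk) (^-*-assoc 5 (6 * t) kk) ⟨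
    (20 ^ (20 * (5 * t + 6))) ^ kk * (5 ^ (6 * t)) ^ kk
                                                     ≡⟨ ^-distribʳ-* _ _ kk ⟨
    (20 ^ (20 * (5 * t + 6)) * 5 ^ (6 * t)) ^ kk     ≤⟨ ^-monoˡ-≤ kk ([20/19]¹⁰⁰ᵗ⁺¹²⁰≤[12/5]⁶ᵗ t 50≤t) ⟩
    (19 ^ (20 * (5 * t + 6)) * 12 ^ (6 * t)) ^ kk    ≡⟨ ^-distribʳ-* _ _ kk ⟩
    (19 ^ (20 * (5 * t + 6))) ^ kk * (12 ^ (6 * t)) ^ kk
                                                     ≡⟨ cong₂ _*_ (^-*-assoc 19 (20 * (5 * t + 6)) kk) (^-*-assoc 12 (6 * t) kk) ⟩
    19 ^ X * 12 ^ G                                  ∎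

crossing : ∀ {p} {P : ℕ → Set p} → (∀ t → Dec (P t)) → P 0 → ∀ N → ¬ P N → ∃ λ t → P t × ¬ P (suc t)
crossing P? P0 zero    ¬P0 = ⊥-elim (¬P0 P0)
crossing P? P0 (suc N) ¬PN with P? N
... | yes PN = N , PN , ¬PN
... | no ¬PN′ = crossing P? P0 N ¬PN′

n<2ⁿ : ∀ n → n < 2 ^ n
n<2ⁿ zero    = s≤s z≤n
n<2ⁿ (suc n) = ≤-trans (+-mono-≤ (m^n>0 2 n) (n<2ⁿ n)) (≤-reflexive (cong (2 ^ n +_) (sym (+-identityʳ (2 ^ n)))))

11[t+1]≤2ᵗ : ∀ t → 7 ≤ t → 11 * (t + 1) ≤ 2 ^ t
11[t+1]≤2ᵗ = induction-from 7 (≤ᵇ⇒≤ _ _ tt) λ t 7≤t ih → begin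
  11 * (suc t + 1)       ≡⟨ solve 1 (λ t → con 11 :* ((con 1 :+ t) :+ con 1) := con 11 :* (t :+ con 1) :+ con 11) refl t ⟩
  11 * (t + 1) + 11      ≤⟨ +-mono-≤ ih (≤-trans (m≤m*n 11 (t + 1) {{subst NonZero (+-comm 1 t) _}}) ih) ⟩
  2 ^ t + 2 ^ t          ≡⟨ cong (2 ^ t +_) (+-identityʳ (2 ^ t)) ⟨
  2 * 2 ^ t              ∎
  where open ≤-Reasoning

module _ (k : ℕ) where

  -- (20/19)^{20t} ≤ k, a certificate for t ≤ ln k.
  Fits : ℕ → Set
  Fits t = 20 ^ (20 * t) ≤ k * 19 ^ (20 * t)

  private
    fits? : ∀ t → Dec (Fits t)
    fits? t = 20 ^ (20 * t) ≤? k * 19 ^ (20 * t)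

    Fits-suc⁻ : ∀ t → Fits (suc t) → Fits t
    Fits-suc⁻ t fits = *-cancelʳ-≤ _ _ (19 ^ 20) (begin
      20 ^ (20 * t) * 19 ^ 20        ≤⟨ *-monoʳ-≤ (20 ^ (20 * t)) (^-monoˡ-≤ 20 (≤ᵇ⇒≤ 19 20 tt)) ⟩
      20 ^ (20 * t) * 20 ^ 20        ≡⟨ trans (cong (20 ^_) 20[1+t]≡20t+20) (^-distribˡ-+-* 20 (20 * t) 20) ⟨
      20 ^ (20 * suc t)              ≤⟨ fits ⟩
      k * 19 ^ (20 * suc t)          ≡⟨ cong (k *_) (trans (cong (19 ^_) 20[1+t]≡20t+20) (^-distribˡ-+-* 19 (20 * t) 20)) ⟩
      k * (19 ^ (20 * t) * 19 ^ 20)  ≡⟨ *-assoc k _ _ ⟨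
      k * 19 ^ (20 * t) * 19 ^ 20    ∎)
      where
      open ≤-Reasoning
      20[1+t]≡20t+20 : 20 * suc t ≡ 20 * t + 20
      20[1+t]≡20t+20 = trans (*-suc 20 t) (+-comm 20 (20 * t))

    Fits-antitone : ∀ {s t} → s ≤ t → Fits t → Fits s
    Fits-antitone {s} s≤t fits with m≤n⇒∃[o]m+o≡n s≤t
    ... | d , refl = go d fits
      where
      go : ∀ d → Fits (s + d) → Fits s
      go zero    = subst Fits (+-identityʳ s)
      go (suc d) = go d ∘′ Fits-suc⁻ (s + d) ∘′ subst Fits (+-suc s d)

    Fits⇒2ᵗ≤k : ∀ t → Fits t → 2 ^ t ≤ k
    Fits⇒2ᵗ≤k t fits = *-cancelʳ-≤ _ _ (19 ^ (20 * t)) {{m^n≢0 19 (20 * t)}} (begin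
      2 ^ t * 19 ^ (20 * t)    ≡⟨ cong (2 ^ t *_) (^-*-assoc 19 20 t) ⟨
      2 ^ t * (19 ^ 20) ^ t    ≡⟨ ^-distribʳ-* 2 (19 ^ 20) t ⟨
      (2 * 19 ^ 20) ^ t        ≤⟨ ^-monoˡ-≤ t (≤ᵇ⇒≤ _ _ tt) ⟩
      (20 ^ 20) ^ t            ≡⟨ ^-*-assoc 20 20 t ⟩
      20 ^ (20 * t)            ≤⟨ fits ⟩
      k * 19 ^ (20 * t)        ∎)
      where open ≤-Reasoning

  choose-t : 20 ^ 1000 ≤ k → ∃ λ t → Fits t × ¬ Fits (suc t) × 50 ≤ t × 11 * (t + 1) ≤ k
  choose-t 20¹⁰⁰⁰≤k = certify (crossing fits? Fits-0 k ¬Fits-k)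
    where
    Fits-0 : Fits 0
    Fits-0 = ≤-trans (≤-trans (m^n>0 20 1000) 20¹⁰⁰⁰≤k) (≤-reflexive (sym (*-identityʳ k)))
    ¬Fits-k : ¬ Fits k
    ¬Fits-k fits = <⇒≱ (n<2ⁿ k) (Fits⇒2ᵗ≤k k fits)
    Fits-50 : Fits 50
    Fits-50 = ≤-trans 20¹⁰⁰⁰≤k (m≤m*n k (19 ^ 1000) {{m^n≢0 19 1000}})
    certify : (∃ λ t → Fits t × ¬ Fits (suc t)) → ∃ λ t → Fits t × ¬ Fits (suc t) × 50 ≤ t × 11 * (t + 1) ≤ k
    certify (t , fits , ¬fits) =
      t , fits , ¬fits , 50≤t , ≤-trans (11[t+1]≤2ᵗ t (≤-trans (≤ᵇ⇒≤ 7 50 tt) 50≤t)) (Fits⇒2ᵗ≤k t fits)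
      where
      50≤t : 50 ≤ t
      50≤t = ≮⇒≥ (λ t<50 → ¬fits (Fits-antitone t<50 Fits-50))

∃[12a]-between : ∀ x → ∃ λ a → x ≤ 12 * a × 12 * a ≤ x + 11
∃[12a]-between x = a , +-cancelʳ-≤ 11 x (12 * a) x+11≤12a+11 , ≤-trans (≤-reflexive (*-comm 12 a)) (m/n*n≤m (x + 11) 12)
  where
  a = (x + 11) / 12
  x+11≤12a+11 : x + 11 ≤ 12 * a + 11
  x+11≤12a+11 = begin
    x + 11                     ≡⟨ m≡m%n+[m/n]*n (x + 11) 12 ⟩
    (x + 11) % 12 + a * 12     ≤⟨ +-monoˡ-≤ (a * 12) (s≤s⁻¹ (m%n<n (x + 11) 12)) ⟩
    11 + a * 12                ≡⟨ trans (+-comm 11 _) (cong (_+ 11) (*-comm a 12)) ⟩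
    12 * a + 11                ∎
    where open ≤-Reasoning

sparse-graph : ∀ k t a → 1500 ≤ k → Fits k t → ¬ Fits k (suc t) → 50 ≤ t → 11 * (t + 1) ≤ k →
               5 * k ≤ 12 * a → 12 * a ≤ 5 * k + 11 →
               ∃ λ n → ∃ λ (H : OrientedKGraph k n) → PropertyO H × numEdges H ≤ (k ^ 2 * k !) *ln k
sparse-graph k t a 1500≤k fits ¬fits 50≤t 11[t+1]≤k 5k≤12a 12a≤5k+11 =
  n , graph m m≤aᵏ , graph-propertyO m m≤aᵏ few , *ln-intro (k ^ 2 * k !) k (numEdges-graph m m≤aᵏ) (≤ln-intro 19 t k fits)
  where
  open Construction k a
  m = k ^ 2 * k ! * t
  t≤k : t ≤ k
  t≤k = ≤-trans (≤-trans (m≤m+n t 1) (m≤n*m (t + 1) 11)) 11[t+1]≤k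
  m≤aᵏ : m ≤ a ^ k
  m≤aᵏ = k²k!t≤aᵏ k a t 1500≤k t≤k 5k≤12a
  12n≤5kk+11k : 12 * n ≤ 5 * (k * k) + 11 * k
  12n≤5kk+11k = begin
    12 * (k * a)         ≡⟨ solve 2 (λ k a → con 12 :* (k :* a) := k :* (con 12 :* a)) refl k a ⟩
    k * (12 * a)         ≤⟨ *-monoʳ-≤ k 12a≤5k+11 ⟩
    k * (5 * k + 11)     ≡⟨ solve 1 (λ k → k :* (con 5 :* k :+ con 11) := con 5 :* (k :* k) :+ con 11 :* k) refl k ⟩
    5 * (k * k) + 11 * k ∎
    where open ≤-Reasoning
  k19ᵀ<20ᵀ : k * 19 ^ (20 * (t + 1)) < 20 ^ (20 * (t + 1))
  k19ᵀ<20ᵀ = subst (λ s → k * 19 ^ (20 * s) < 20 ^ (20 * s)) (+-comm 1 t) (≰⇒> ¬fits)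
  few : (k ! ∸ 1) ^ m * n ^ n < (k !) ^ m
  few = subst (λ e → (k ! ∸ 1) ^ e * n ^ n < (k !) ^ e)
              (solve 3 (λ f k t → f :* (k :* k :* t) := k :* (k :* con 1) :* f :* t) refl (k !) k t)
              ([K∸1]ᴷʲnⁿ<Kᴷʲ (k !) (k * k * t) n (≤-trans (≤ᵇ⇒≤ 6 1500 tt) (≤-trans 1500≤k (n≤n! k)))
                             (nⁿ5ᵏᵏᵗ<12ᵏᵏᵗ k n t 50≤t 11[t+1]≤k 12n≤5kk+11k k19ᵀ<20ᵀ))

theorem1 : ((k : ℕ) → 2 ≤ k → (n : ℕ) → (H : OrientedKGraph k n) → PropertyO H → k ! ≤ numEdges H)
    × (∃ λ k₀ → (k : ℕ) → k₀ ≤ k → ∃ λ n → ∃ λ (H : OrientedKGraph k n) → PropertyO H × (numEdges H ≤ (k ^ 2 * k !) *ln k))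
theorem1 = (λ k _ n → k!≤numEdges) , (20 ^ 1000 , upper)
  -- k!≤numEdges holds for every k
  where
  upper : ∀ k → 20 ^ 1000 ≤ k → ∃ λ n → ∃ λ (H : OrientedKGraph k n) → PropertyO H × numEdges H ≤ (k ^ 2 * k !) *ln k
  upper k k₀≤k =
    let t , fits , ¬fits , 50≤t , 11[t+1]≤k = choose-t k k₀≤k
        a , 5k≤12a , 12a≤5k+11 = ∃[12a]-between (5 * k)
    in  sparse-graph k t a (≤-trans (≤ᵇ⇒≤ 1500 (20 ^ 1000) tt) k₀≤k) fits ¬fits 50≤t 11[t+1]≤k 5k≤12a 12a≤5k+11
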